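{- For positive integers $u,v$ let $$\Delta(u,v)=(-1)^{u(u-1)/2}\prod_{j=1}^{u} j^j\prod_{j=1}^{u-1}(v+j)^{u-j}.$$ Then $\operatorname{disc} P(u,v,x)=\Delta(u,v)$ and $\operatorname{disc} Q(u,v,x)=\Delta(v,u)$.
   Context: For positive integers $u,v$ define $P(u,v,x)=\sum_{j=0}^{u}\frac{(u+v-j)!}{v!}\binom{u}{j}x^j$ and $Q(u,v,x)=\sum_{j=0}^{v}\frac{(u+v-j)!}{u!}\binom{v}{j}(-x)^j$. $\operatorname{disc}$ denotes the polynomial discriminant. -}

module Defs where

open import Data.Nat as ℕ using (ℕ; zero; suc; _!; _∸_)
open import Data.Nat.Properties using (_!≢0)
open import Data.Nat.Combinatorics using (_C_)
open import Data.Integer as ℤ using (ℤ; +_; -[1+_]; +0; +[1+_]; _*_; _+_; _^_; -_; _/_)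
open import Data.List as L using (List; []; _∷_; length; reverse; dropWhileᵇ)
open import Data.Fin as F using (Fin; zero; suc; toℕ; punchIn)
open import Data.Bool using (Bool)

-- A polynomial over ℤ is its list of coefficients, lowest degree first:
-- [a₀ , a₁ , … , aₘ] represents a₀ + a₁ x + … + aₘ xᵐ.
Poly : Set
Poly = List ℤ

isZero : ℤ → Bool
isZero (+ zero) = Bool.true
isZero _        = Bool.false

normalize : Poly → Poly
normalize f = reverse (dropWhileᵇ isZero (reverse f))

coef : Poly → ℕ → ℤ
coef []       _       = + 0
coef (a ∷ _)  zero    = a
coef (_ ∷ as) (suc i) = coef as i

derivAux : ℕ → Poly → Poly
derivAux k []       = []
derivAux k (c ∷ cs) = (+ k) * c ∷ derivAux (suc k) cs

deriv : Poly → Poly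
deriv []       = []
deriv (_ ∷ as) = derivAux 1 as

sgn : ℕ → ℤ
sgn k = (- (+ 1)) ^ k

ΣFin : (n : ℕ) → (Fin n → ℤ) → ℤ
ΣFin zero    f = + 0
ΣFin (suc n) f = f zero + ΣFin n (λ i → f (suc i))

det : (n : ℕ) → (Fin n → Fin n → ℤ) → ℤ
det zero    M = + 1
det (suc n) M = ΣFin (suc n) (λ j →
  sgn (toℕ j) * M zero j * det n (λ r c → M (suc r) (punchIn j c)))

-- entry of a shifted coefficient row: row shift s, column c, polynomial
-- of degree d with coefficients a: a_{d - (c - s)} if s ≤ c ≤ s + d, else 0
shiftedEntry : Poly → ℕ → ℕ → ℕ → ℤ
shiftedEntry a d s c with c ℕ.<ᵇ s | d ℕ.<ᵇ (c ∸ s)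
... | Bool.true  | _          = + 0
... | Bool.false | Bool.true  = + 0
... | Bool.false | Bool.false = coef a (d ∸ (c ∸ s))

-- Sylvester matrix of f (degree m) and g (degree n): (m+n)×(m+n),
-- first n rows are shifts of the coefficients of f (leading first),
-- last m rows are shifts of the coefficients of g.
sylvester : (f : Poly) (m : ℕ) (g : Poly) (n : ℕ) → Fin (n ℕ.+ m) → Fin (n ℕ.+ m) → ℤ
sylvester f m g n r c with toℕ r ℕ.<ᵇ n
... | Bool.true  = shiftedEntry f m (toℕ r) (toℕ c)
... | Bool.false = shiftedEntry g n (toℕ r ∸ n) (toℕ c)

degree : Poly → ℕ
degree f = length f ∸ 1

lead : Poly → ℤ
lead f = coef f (degree f)

resultant : Poly → Poly → ℤ
resultant f g = det (degree g ℕ.+ degree f) (sylvester f (degree f) g (degree g))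

-- discriminant: disc f = (-1)^{m(m-1)/2} Res(f, f') / a_m, m = deg f, a_m = lead f.
-- Convention for the zero polynomial (no leading coefficient): 0.
discAux : Poly → ℤ → ℤ
discAux f (+ zero)    = + 0
discAux f a@(+[1+ _ ]) = (sgn ((m ℕ.* (m ∸ 1)) ℕ./ 2) * resultant f (normalize (deriv f))) / a
  where m = degree f
discAux f a@(-[1+ _ ]) = (sgn ((m ℕ.* (m ∸ 1)) ℕ./ 2) * resultant f (normalize (deriv f))) / a
  where m = degree f

disc : Poly → ℤ
disc f = discAux (normalize f) (lead (normalize f))

tab : (k : ℕ) → (ℕ → ℤ) → Poly
tab k t = L.map t (L.upTo (suc k))

P : ℕ → ℕ → Poly
P u v = tab u (λ j → + (((((u ℕ.+ v) ∸ j) !) ℕ./ (v !)) {{v !≢0}} ℕ.* (u C j)))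

Q : ℕ → ℕ → Poly
Q u v = tab v (λ j → sgn j * + (((((u ℕ.+ v) ∸ j) !) ℕ./ (u !)) {{u !≢0}} ℕ.* (v C j)))

-- ∏_{j=a}^{b} t j  (empty product = 1 when b < a)
prodFrom : ℕ → ℕ → (ℕ → ℤ) → ℤ
prodFrom a b t = L.foldr _*_ (+ 1) (L.map (λ i → t (a ℕ.+ i)) (L.upTo (suc b ∸ a)))

Δ : ℕ → ℕ → ℤ
Δ u v = sgn ((u ℕ.* (u ∸ 1)) ℕ./ 2)
      * prodFrom 1 u (λ j → (+ j) ^ j)
      * prodFrom 1 (u ∸ 1) (λ j → (+ (v ℕ.+ j)) ^ (u ∸ j))

-- Read from the top, P(a, b) has coefficients (b + k)!/b! · C(a, k), and
-- Q(u, v)(x) = P(v, u)(-x), so both are treated as P(a, b)(σx), σ = ±1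
-- (module Twisted).  Pascal-type identities give P(a, b)′ = a·P(a - 1, b) and
--   P(a + 2, b) = (σx + b + 1)·P(a + 1, b)     + (a + 1)(b + 1)·P(a, b + 1),
--   P(a + 2, b) = (σx + b - a)·P(a + 1, b + 1) + (a + 1)(b + 2)·P(a, b + 2).
-- If F = (αx + e)G + H, row operations on the Sylvester matrix and two
-- first-column expansions give Res(F, G) = lead(G)²·Res(H, G) (and symmetrically
-- for the other block).  As all leading coefficients are ±1, iterating this
-- evaluates Res(P, P′) in closed form, which is then rearranged into Δ.

module Submission where

open import Defs
open import Data.Nat as ℕ using (ℕ; zero; suc; z≤n; s≤s; _≤_; _!)
import Data.Nat.Properties as ℕP
open import Data.Nat.Properties using (_!≢0)
open import Data.Nat.Combinatorics using (_C_; nCk+nC[k+1]≡[n+1]C[k+1]; nC1≡n; nCk≡nC[n∸k]; k>n⇒nCk≡0)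
import Data.Nat.DivMod as ℕDM
import Data.Nat.Tactic.RingSolver as ℕSolver
open import Data.Integer as ℤ using (ℤ; +_; -_; _+_; _*_; 0ℤ; 1ℤ; -1ℤ; _^_; +[1+_]; -[1+_])
import Data.Integer.Properties as ℤP
open import Data.Integer.Tactic.RingSolver using (solve-∀)
open import Data.Fin using (Fin; zero; suc; toℕ; punchIn)
open import Data.Fin.Properties using (toℕ<n)
open import Data.List as L using ([]; _∷_; _∷ʳ_; applyUpTo; reverse)
import Data.List.Properties as LP
open import Data.Bool using (true; false; T)
open import Data.Empty using (⊥-elim)
open import Data.Product using (_×_; _,_; proj₁; proj₂)
open import Data.Sum using (_⊎_; inj₁; inj₂)
open import Relation.Binary.Definitions using (tri<; tri≈; tri>)
open import Relation.Binary.PropositionalEquality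
open import Relation.Nullary using (yes; no)
open import Function using (_∘_)

-- ∑ n f = f 0 + … + f (n - 1): the ℕ-indexed counterpart of ΣFin, which is
-- easier to reindex than sums over Fin.
∑ : ℕ → (ℕ → ℤ) → ℤ
∑ zero    f = 0ℤ
∑ (suc n) f = f 0 + ∑ n (λ i → f (suc i))

ΣFin≡∑ : ∀ n (f : ℕ → ℤ) → ΣFin n (λ j → f (toℕ j)) ≡ ∑ n f
ΣFin≡∑ zero    f = refl
ΣFin≡∑ (suc n) f = cong (_+_ (f 0)) (ΣFin≡∑ n (λ i → f (suc i)))

ΣFin-cong : ∀ n {f g : Fin n → ℤ} → (∀ j → f j ≡ g j) → ΣFin n f ≡ ΣFin n g
ΣFin-cong zero    h = refl
ΣFin-cong (suc n) h = cong₂ _+_ (h zero) (ΣFin-cong n (λ j → h (suc j)))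

∑-cong : ∀ n {f g : ℕ → ℤ} → (∀ i → i ℕ.< n → f i ≡ g i) → ∑ n f ≡ ∑ n g
∑-cong zero    h = refl
∑-cong (suc n) h = cong₂ _+_ (h 0 (s≤s z≤n)) (∑-cong n (λ i i<n → h (suc i) (s≤s i<n)))

∑-+ : ∀ n (f g : ℕ → ℤ) → ∑ n (λ i → f i + g i) ≡ ∑ n f + ∑ n g
∑-+ zero    f g = refl
∑-+ (suc n) f g = trans (cong (_+_ (f 0 + g 0)) (∑-+ n _ _)) (interchange (f 0) (g 0) _ _)
  where
  interchange : ∀ a b c d → a + b + (c + d) ≡ a + c + (b + d)
  interchange = solve-∀

∑-*ˡ : ∀ n k (f : ℕ → ℤ) → k * ∑ n f ≡ ∑ n (λ i → k * f i)
∑-*ˡ zero    k f = ℤP.*-zeroʳ k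
∑-*ˡ (suc n) k f = trans (ℤP.*-distribˡ-+ k (f 0) _) (cong (_+_ (k * f 0)) (∑-*ˡ n k _))

∑-neg : ∀ n (f : ℕ → ℤ) → - ∑ n f ≡ ∑ n (λ i → - f i)
∑-neg zero    f = refl
∑-neg (suc n) f = trans (ℤP.neg-distrib-+ (f 0) _) (cong (_+_ (- f 0)) (∑-neg n _))

∑-linear : ∀ n a b (f g : ℕ → ℤ) → ∑ n (λ j → a * f j + b * g j) ≡ a * ∑ n f + b * ∑ n g
∑-linear n a b f g =
  trans (∑-+ n (λ j → a * f j) (λ j → b * g j))
        (sym (cong₂ _+_ (∑-*ˡ n a f) (∑-*ˡ n b g)))

∑-zero : ∀ n {f : ℕ → ℤ} → (∀ i → i ℕ.< n → f i ≡ 0ℤ) → ∑ n f ≡ 0ℤ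
∑-zero zero    h = refl
∑-zero (suc n) h = cong₂ _+_ (h 0 (s≤s z≤n)) (∑-zero n (λ i i<n → h (suc i) (s≤s i<n)))

∑-comm : ∀ n m (f : ℕ → ℕ → ℤ) →
  ∑ n (λ i → ∑ m (λ j → f i j)) ≡ ∑ m (λ j → ∑ n (λ i → f i j))
∑-comm zero    m f = sym (∑-zero m (λ _ _ → refl))
∑-comm (suc n) m f =
  trans (cong (_+_ (∑ m (f 0))) (∑-comm n m (λ i → f (suc i))))
        (sym (∑-+ m (f 0) (λ j → ∑ n (λ i → f (suc i) j))))

∑-single : ∀ n (f : ℕ → ℤ) p → p ℕ.< n → (∀ i → i ℕ.< n → i ≢ p → f i ≡ 0ℤ) → ∑ n f ≡ f p
∑-single (suc n) f zero p<n h =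
  trans (cong (_+_ (f 0)) (∑-zero n (λ i i<n → h (suc i) (s≤s i<n) (λ ())))) (ℤP.+-identityʳ (f 0))
∑-single (suc n) f (suc p) (s≤s p<n) h =
  trans (cong₂ _+_ (h 0 (s≤s z≤n) (λ ()))
                   (∑-single n (λ i → f (suc i)) p p<n
                      (λ i i<n i≢p → h (suc i) (s≤s i<n) (i≢p ∘ ℕP.suc-injective))))
        (ℤP.+-identityˡ _)

-- punchInℕ j c is the c-th natural number different from j: the ℕ-version of
-- Fin.punchIn, used to index the columns of a minor.
punchInℕ : ℕ → ℕ → ℕ
punchInℕ zero    c       = suc c
punchInℕ (suc j) zero    = zero
punchInℕ (suc j) (suc c) = suc (punchInℕ j c)

toℕ-punchIn : ∀ {n} (j : Fin (suc n)) (c : Fin n) → toℕ (punchIn j c) ≡ punchInℕ (toℕ j) (toℕ c)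
toℕ-punchIn zero    c       = refl
toℕ-punchIn (suc j) zero    = refl
toℕ-punchIn (suc j) (suc c) = cong suc (toℕ-punchIn j c)

punchInℕ-< : ∀ j c → c ℕ.< j → punchInℕ j c ≡ c
punchInℕ-< (suc j) zero    _         = refl
punchInℕ-< (suc j) (suc c) (s≤s c<j) = cong suc (punchInℕ-< j c c<j)

punchInℕ-≥ : ∀ j c → j ≤ c → punchInℕ j c ≡ suc c
punchInℕ-≥ zero    c       _         = refl
punchInℕ-≥ (suc j) (suc c) (s≤s j≤c) = cong suc (punchInℕ-≥ j c j≤c)

-- The determinant of the N×N matrix read off from E : ℕ → ℕ → ℤ.  Working
-- with ℕ-indexed matrices lets rows and columns be reindexed arithmetically.
detℕ : ℕ → (ℕ → ℕ → ℤ) → ℤ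
detℕ N E = det N (λ r c → E (toℕ r) (toℕ c))

det-cong : ∀ n {M M′ : Fin n → Fin n → ℤ} → (∀ r c → M r c ≡ M′ r c) → det n M ≡ det n M′
det-cong zero    h = refl
det-cong (suc n) h = ΣFin-cong (suc n) (λ j →
  cong₂ (λ a b → sgn (toℕ j) * a * b) (h zero j) (det-cong n (λ r c → h (suc r) (punchIn j c))))

detℕ-cong : ∀ N {E E′ : ℕ → ℕ → ℤ} → (∀ r c → r ℕ.< N → c ℕ.< N → E r c ≡ E′ r c) →
  detℕ N E ≡ detℕ N E′
detℕ-cong N h = det-cong N (λ r c → h (toℕ r) (toℕ c) (toℕ<n r) (toℕ<n c))

detℕ-size : ∀ {N N′} E → N ≡ N′ → detℕ N E ≡ detℕ N′ E
detℕ-size E refl = refl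

detℕ-expand : ∀ N E → detℕ (suc N) E ≡
  ∑ (suc N) (λ j → sgn j * E 0 j * detℕ N (λ r c → E (suc r) (punchInℕ j c)))
detℕ-expand N E =
  trans (ΣFin-cong (suc N) (λ j → cong (λ x → sgn (toℕ j) * E 0 (toℕ j) * x)
           (det-cong N (λ r c → cong (E (suc (toℕ r))) (toℕ-punchIn j c)))))
        (ΣFin≡∑ (suc N) (λ j → sgn j * E 0 j * detℕ N (λ r c → E (suc r) (punchInℕ j c))))

-- A "minor functional" ρ assigns to a column reindexing σ the determinant of
-- the remaining rows restricted to the columns σ 0, σ 1, …; it must only
-- depend on the values of σ.
Extensional : ((ℕ → ℕ) → ℤ) → Set
Extensional ρ = ∀ σ τ → (∀ c → σ c ≡ τ c) → ρ σ ≡ ρ τ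

fix0 : (ℕ → ℕ) → ℕ → ℕ
fix0 σ zero    = zero
fix0 σ (suc c) = suc (σ c)

fix0-extensional : ∀ ρ → Extensional ρ → Extensional (λ σ → ρ (fix0 σ))
fix0-extensional ρ ext σ τ h = ext (fix0 σ) (fix0 τ) (λ { zero → refl ; (suc c) → cong suc (h c) })

-- Expanding a determinant along its first two rows f and g gives the double
-- sum `twoRows N f g` below.  Exchanging f and g negates it: the j = 0 terms
-- of one side match the k = 0 terms of the other, and the remaining terms
-- form the same double sum one size smaller (with minor functional ρ ∘ fix0).
module TwoRows (ρ : (ℕ → ℕ) → ℤ) where
  minorAt : ℕ → ℕ → ℤ
  minorAt j k = ρ (λ c → punchInℕ j (punchInℕ k c))

  term : (f g : ℕ → ℤ) → ℕ → ℕ → ℤ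
  term f g j k = sgn j * sgn k * f j * g (punchInℕ j k) * minorAt j k

  twoRows : ℕ → (f g : ℕ → ℤ) → ℤ
  twoRows N f g = ∑ (suc (suc N)) (λ j → ∑ (suc N) (term f g j))

  -- the terms with j = 0, with k = 0 (and j > 0), and with j, k > 0; the
  -- signs of the last two absorb the shift of j and k by one
  jZero kZero : (f g : ℕ → ℤ) → ℕ → ℤ
  jZero f g k = sgn k * f 0 * g (suc k) * minorAt 0 k
  kZero f g a = - (sgn a * f (suc a) * g 0 * minorAt (suc a) 0)

  innerTerm : (f g : ℕ → ℤ) → ℕ → ℕ → ℤ
  innerTerm f g a b = sgn a * sgn b * f (suc a) * g (suc (punchInℕ a b)) * minorAt (suc a) (suc b)

  inner : ℕ → (f g : ℕ → ℤ) → ℤ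
  inner N f g = ∑ (suc N) (λ a → ∑ N (innerTerm f g a))

  split : ∀ N f g → twoRows N f g ≡ ∑ (suc N) (jZero f g) + (∑ (suc N) (kZero f g) + inner N f g)
  split N f g = cong₂ _+_
    (∑-cong (suc N) (λ k _ → sign₀ (sgn k) (f 0) (g (suc k)) (minorAt 0 k)))
    (trans (∑-cong (suc N) (λ a _ → cong₂ _+_ (sign₁ (sgn a) (f (suc a)) (g 0) (minorAt (suc a) 0))
                   (∑-cong N (λ b _ →
                      sign₂ (sgn a) (sgn b) (f (suc a)) (g (suc (punchInℕ a b))) (minorAt (suc a) (suc b))))))
           (∑-+ (suc N) (kZero f g) (λ a → ∑ N (innerTerm f g a))))
    where
    sign₀ : ∀ s x y r → 1ℤ * s * x * y * r ≡ s * x * y * r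
    sign₀ = solve-∀
    sign₁ : ∀ s x y r → -1ℤ * s * 1ℤ * x * y * r ≡ - (s * x * y * r)
    sign₁ = solve-∀
    sign₂ : ∀ s t x y r → -1ℤ * s * (-1ℤ * t) * x * y * r ≡ s * t * x * y * r
    sign₂ = solve-∀

  jZero-swap : ∀ N f g → ∑ (suc N) (jZero g f) ≡ - ∑ (suc N) (kZero f g)
  jZero-swap N f g =
    trans (∑-cong (suc N) (λ k _ → reorder (sgn k) (g 0) (f (suc k)) (minorAt 0 k)))
          (sym (∑-neg (suc N) (kZero f g)))
    where
    reorder : ∀ s x y r → s * x * y * r ≡ - - (s * y * x * r)
    reorder = solve-∀

  kZero-swap : ∀ N f g → ∑ (suc N) (kZero g f) ≡ - ∑ (suc N) (jZero f g)
  kZero-swap N f g =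
    trans (∑-cong (suc N) (λ k _ → reorder (sgn k) (g (suc k)) (f 0) (minorAt 0 k)))
          (sym (∑-neg (suc N) (jZero f g)))
    where
    reorder : ∀ s x y r → - (s * x * y * r) ≡ - (s * y * x * r)
    reorder = solve-∀

-- The inner terms are the double sum for the smaller minor functional ρ ∘ fix0,
-- which makes the induction in twoRows-swap possible.
inner-twoRows : ∀ N ρ → Extensional ρ → ∀ f g →
  TwoRows.inner ρ (suc N) f g ≡ TwoRows.twoRows (λ σ → ρ (fix0 σ)) N (f ∘ suc) (g ∘ suc)
inner-twoRows N ρ ext f g = ∑-cong (suc (suc N)) (λ a _ → ∑-cong (suc N) (λ b _ →
  cong (λ t → sgn a * sgn b * f (suc a) * g (suc (punchInℕ a b)) * t)
       (ext (λ c → punchInℕ (suc a) (punchInℕ (suc b) c)) (fix0 (λ c → punchInℕ a (punchInℕ b c)))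
            (λ { zero → refl ; (suc c) → refl }))))

twoRows-swap : ∀ N ρ → Extensional ρ → ∀ f g → TwoRows.twoRows ρ N g f ≡ - TwoRows.twoRows ρ N f g
twoRows-swap N ρ ext f g =
  begin
    twoRows N g f
  ≡⟨ split N g f ⟩
    ∑ (suc N) (jZero g f) + (∑ (suc N) (kZero g f) + inner N g f)
  ≡⟨ cong₂ _+_ (jZero-swap N f g) (cong₂ _+_ (kZero-swap N f g) (inner-swap N)) ⟩
    - ∑ (suc N) (kZero f g) + (- ∑ (suc N) (jZero f g) + - inner N f g)
  ≡⟨ regroup (∑ (suc N) (jZero f g)) (∑ (suc N) (kZero f g)) (inner N f g) ⟩
    - (∑ (suc N) (jZero f g) + (∑ (suc N) (kZero f g) + inner N f g))
  ≡⟨ cong -_ (sym (split N f g)) ⟩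
    - twoRows N f g
  ∎
  where
  open ≡-Reasoning
  open TwoRows ρ
  regroup : ∀ a b c → - b + (- a + - c) ≡ - (a + (b + c))
  regroup = solve-∀
  inner-swap : ∀ N → inner N g f ≡ - inner N f g
  inner-swap zero     = trans (∑-zero 1 (λ _ _ → refl)) (sym (cong -_ (∑-zero 1 (λ _ _ → refl))))
  inner-swap (suc N′) =
    trans (inner-twoRows N′ ρ ext g f)
   (trans (twoRows-swap N′ (λ σ → ρ (fix0 σ)) (fix0-extensional ρ ext) (f ∘ suc) (g ∘ suc))
          (cong -_ (sym (inner-twoRows N′ ρ ext f g))))

detℕ-twoRows : ∀ N E → detℕ (suc (suc N)) E ≡
  TwoRows.twoRows (λ σ → detℕ N (λ r c → E (suc (suc r)) (σ c))) N (E 0) (E 1)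
detℕ-twoRows N E =
  trans (detℕ-expand (suc N) E)
        (∑-cong (suc (suc N)) (λ j _ →
          trans (cong (λ t → sgn j * E 0 j * t) (detℕ-expand N (λ r c → E (suc r) (punchInℕ j c))))
         (trans (∑-*ˡ (suc N) (sgn j * E 0 j) (λ k → sgn k * E 1 (punchInℕ j k) * minor j k))
                (∑-cong (suc N) (λ k _ → reorder (sgn j) (E 0 j) (sgn k) (E 1 (punchInℕ j k)) (minor j k))))))
  where
  minor : ℕ → ℕ → ℤ
  minor j k = detℕ N (λ r c → E (suc (suc r)) (punchInℕ j (punchInℕ k c)))
  reorder : ∀ a b c d e → a * b * (c * d * e) ≡ a * c * b * d * e
  reorder = solve-∀

swapAdj : ℕ → ℕ → ℕ
swapAdj zero    zero          = 1
swapAdj zero    (suc zero)    = 0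
swapAdj zero    (suc (suc r)) = suc (suc r)
swapAdj (suc i) zero          = zero
swapAdj (suc i) (suc r)       = suc (swapAdj i r)

detℕ-swapAdj : ∀ N i → suc i ℕ.< N → ∀ E → detℕ N (λ r → E (swapAdj i r)) ≡ - detℕ N E
detℕ-swapAdj (suc (suc N)) zero _ E =
  trans (detℕ-twoRows N (λ r → E (swapAdj 0 r)))
 (trans (twoRows-swap N ρ ρ-ext (E 0) (E 1))
        (cong -_ (sym (detℕ-twoRows N E))))
  where
  ρ : (ℕ → ℕ) → ℤ
  ρ σ = detℕ N (λ r c → E (suc (suc r)) (σ c))
  ρ-ext : Extensional ρ
  ρ-ext σ τ h = detℕ-cong N (λ r c _ _ → cong (E (suc (suc r))) (h c))
detℕ-swapAdj (suc N) (suc i) (s≤s i+1<N) E =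
  trans (detℕ-expand N (λ r → E (swapAdj (suc i) r)))
 (trans (∑-cong (suc N) (λ j _ →
          trans (cong (λ t → sgn j * E 0 j * t) (detℕ-swapAdj N i i+1<N (λ r c → E (suc r) (punchInℕ j c))))
                (sym (ℤP.neg-distribʳ-* (sgn j * E 0 j) _))))
 (trans (sym (∑-neg (suc N) (λ j → sgn j * E 0 j * detℕ N (λ r c → E (suc r) (punchInℕ j c)))))
        (cong -_ (sym (detℕ-expand N E)))))

self-neg⇒0 : ∀ x → x ≡ - x → x ≡ 0ℤ
self-neg⇒0 (+ zero)  _ = refl
self-neg⇒0 (+ suc n) ()
self-neg⇒0 -[1+ n ]  ()

swapAdj-< : ∀ i r → r ℕ.< i → swapAdj i r ≡ r
swapAdj-< (suc i) zero    _         = refl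
swapAdj-< (suc i) (suc r) (s≤s r<i) = cong suc (swapAdj-< i r r<i)

swapAdj-at : ∀ i → swapAdj i i ≡ suc i
swapAdj-at zero    = refl
swapAdj-at (suc i) = cong suc (swapAdj-at i)

swapAdj-equal : ∀ i (E : ℕ → ℕ → ℤ) → (∀ c → E i c ≡ E (suc i) c) → ∀ r c → E (swapAdj i r) c ≡ E r c
swapAdj-equal zero    E h zero          c = sym (h c)
swapAdj-equal zero    E h (suc zero)    c = h c
swapAdj-equal zero    E h (suc (suc r)) c = refl
swapAdj-equal (suc i) E h zero          c = refl
swapAdj-equal (suc i) E h (suc r)       c = swapAdj-equal i (λ r′ → E (suc r′)) h r c

-- A matrix with two equal rows has determinant zero: for adjacent rows the
-- determinant equals its own negative, and in general row p is moved next to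
-- row i by adjacent exchanges.
detℕ-equalRows : ∀ N i p → i ℕ.< p → p ℕ.< N → ∀ E → (∀ c → E i c ≡ E p c) → detℕ N E ≡ 0ℤ
detℕ-equalRows N i (suc p) i<p+1 p+1<N E h with ℕP.m<1+n⇒m<n∨m≡n i<p+1
... | inj₂ refl = self-neg⇒0 _
      (trans (sym (detℕ-cong N {λ r → E (swapAdj i r)} (λ r c _ _ → swapAdj-equal i E h r c))) (detℕ-swapAdj N i p+1<N E))
... | inj₁ i<p =
  begin
    detℕ N E
  ≡⟨ sym (ℤP.neg-involutive (detℕ N E)) ⟩
    - - detℕ N E
  ≡⟨ cong -_ (sym (detℕ-swapAdj N p p+1<N E)) ⟩
    - detℕ N (λ r → E (swapAdj p r))
  ≡⟨ cong -_ (detℕ-equalRows N i p i<p (ℕP.<-trans (ℕP.n<1+n p) p+1<N) (λ r → E (swapAdj p r)) h′) ⟩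
    - 0ℤ
  ∎
  where
  open ≡-Reasoning
  h′ : ∀ c → E (swapAdj p i) c ≡ E (swapAdj p p) c
  h′ c = trans (cong (λ t → E t c) (swapAdj-< p i i<p))
                (trans (h c) (cong (λ t → E t c) (sym (swapAdj-at p))))

setRow : (ℕ → ℕ → ℤ) → ℕ → (ℕ → ℤ) → ℕ → ℕ → ℤ
setRow E zero    v zero    = v
setRow E zero    v (suc r) = E (suc r)
setRow E (suc i) v zero    = E zero
setRow E (suc i) v (suc r) = setRow (λ r′ → E (suc r′)) i v r

setRow-at : ∀ E i v c → setRow E i v i c ≡ v c
setRow-at E zero    v c = refl
setRow-at E (suc i) v c = setRow-at (λ r′ → E (suc r′)) i v c

setRow-other : ∀ E i v r c → r ≢ i → setRow E i v r c ≡ E r c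
setRow-other E zero    v zero    c r≢i = ⊥-elim (r≢i refl)
setRow-other E zero    v (suc r) c r≢i = refl
setRow-other E (suc i) v zero    c r≢i = refl
setRow-other E (suc i) v (suc r) c r≢i = setRow-other (λ r′ → E (suc r′)) i v r c (r≢i ∘ cong suc)

setRow-self : ∀ E i r c → setRow E i (E i) r c ≡ E r c
setRow-self E zero    zero    c = refl
setRow-self E zero    (suc r) c = refl
setRow-self E (suc i) zero    c = refl
setRow-self E (suc i) (suc r) c = setRow-self (λ r′ → E (suc r′)) i r c

setRow-cong : ∀ E i {v w : ℕ → ℤ} → (∀ c → v c ≡ w c) → ∀ r c → setRow E i v r c ≡ setRow E i w r c
setRow-cong E zero    h zero    c = h c
setRow-cong E zero    h (suc r) c = refl
setRow-cong E (suc i) h zero    c = refl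
setRow-cong E (suc i) h (suc r) c = setRow-cong (λ r′ → E (suc r′)) i h r c

setRow-twice : ∀ E i v w r c → setRow (setRow E i v) i w r c ≡ setRow E i w r c
setRow-twice E zero    v w zero    c = refl
setRow-twice E zero    v w (suc r) c = refl
setRow-twice E (suc i) v w zero    c = refl
setRow-twice E (suc i) v w (suc r) c = setRow-twice (λ r′ → E (suc r′)) i v w r c

setRow-columns : ∀ E i v (σ : ℕ → ℕ) r c →
  setRow E i v r (σ c) ≡ setRow (λ r c → E r (σ c)) i (λ c → v (σ c)) r c
setRow-columns E zero    v σ zero    c = refl
setRow-columns E zero    v σ (suc r) c = refl
setRow-columns E (suc i) v σ zero    c = refl
setRow-columns E (suc i) v σ (suc r) c = setRow-columns (λ r′ → E (suc r′)) i v σ r c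

-- For row 0 this is read off the
-- expansion along the first row; for a later row every minor of that
-- expansion is linear in the same row, one size smaller.
detℕ-linear : ∀ N i → i ℕ.< N → ∀ E (x y : ℕ → ℤ) a b →
  detℕ N (setRow E i (λ c → a * x c + b * y c)) ≡ a * detℕ N (setRow E i x) + b * detℕ N (setRow E i y)
detℕ-linear (suc N) zero _ E x y a b =
  trans (detℕ-expand N (setRow E 0 (λ c → a * x c + b * y c)))
 (trans (∑-cong (suc N) (λ j _ → distribute (sgn j) (x j) (y j) a b (minor j)))
 (trans (∑-linear (suc N) a b (λ j → sgn j * x j * minor j) (λ j → sgn j * y j * minor j))
        (sym (cong₂ (λ p q → a * p + b * q) (detℕ-expand N (setRow E 0 x)) (detℕ-expand N (setRow E 0 y))))))
  where
  minor : ℕ → ℤ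
  minor j = detℕ N (λ r c → E (suc r) (punchInℕ j c))
  distribute : ∀ s p q a b m → s * (a * p + b * q) * m ≡ a * (s * p * m) + b * (s * q * m)
  distribute = solve-∀
detℕ-linear (suc N) (suc i) (s≤s i<N) E x y a b =
  trans (expand v)
 (trans (∑-cong (suc N) (λ j _ →
           trans (cong (λ t → sgn j * E 0 j * t)
                       (detℕ-linear N i i<N (minorMatrix j) (λ c → x (punchInℕ j c)) (λ c → y (punchInℕ j c)) a b))
                 (distribute (sgn j * E 0 j) a b (minorWith x j) (minorWith y j))))
 (trans (∑-linear (suc N) a b (λ j → sgn j * E 0 j * minorWith x j) (λ j → sgn j * E 0 j * minorWith y j))
        (sym (cong₂ (λ p q → a * p + b * q) (expand x) (expand y)))))
  where
  minorMatrix : ℕ → ℕ → ℕ → ℤ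
  minorMatrix j r c = E (suc r) (punchInℕ j c)
  minorWith : (ℕ → ℤ) → ℕ → ℤ
  minorWith w j = detℕ N (setRow (minorMatrix j) i (λ c → w (punchInℕ j c)))
  expand : ∀ w → detℕ (suc N) (setRow E (suc i) w) ≡ ∑ (suc N) (λ j → sgn j * E 0 j * minorWith w j)
  expand w = trans (detℕ-expand N (setRow E (suc i) w))
    (∑-cong (suc N) (λ j _ → cong (λ t → sgn j * E 0 j * t)
      (detℕ-cong N (λ r c _ _ → setRow-columns (λ r′ → E (suc r′)) i w (punchInℕ j) r c))))
  v : ℕ → ℤ
  v c = a * x c + b * y c
  distribute : ∀ s a b p q → s * (a * p + b * q) ≡ a * (s * p) + b * (s * q)
  distribute = solve-∀

detℕ-addRow : ∀ N i p → i ℕ.< N → p ℕ.< N → i ≢ p → ∀ E l →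
  detℕ N (setRow E i (λ c → E i c + l * E p c)) ≡ detℕ N E
detℕ-addRow N i p i<N p<N i≢p E l =
  begin
    detℕ N (setRow E i (λ c → E i c + l * E p c))
  ≡⟨ detℕ-cong N (λ r c _ _ → setRow-cong E i (λ c → cong (_+ l * E p c) (sym (ℤP.*-identityˡ (E i c)))) r c) ⟩
    detℕ N (setRow E i (λ c → 1ℤ * E i c + l * E p c))
  ≡⟨ detℕ-linear N i i<N E (E i) (E p) 1ℤ l ⟩
    1ℤ * detℕ N (setRow E i (E i)) + l * detℕ N (setRow E i (E p))
  ≡⟨ cong₂ (λ a b → 1ℤ * a + l * b) (detℕ-cong N (λ r c _ _ → setRow-self E i r c)) repeated ⟩
    1ℤ * detℕ N E + l * 0ℤ
  ≡⟨ simplify (detℕ N E) l ⟩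
    detℕ N E
  ∎
  where
  open ≡-Reasoning
  simplify : ∀ a l → 1ℤ * a + l * 0ℤ ≡ a
  simplify = solve-∀
  U = setRow E i (E p)
  same : ∀ c → U i c ≡ U p c
  same c = trans (setRow-at E i (E p) c) (sym (setRow-other E i (E p) p c (i≢p ∘ sym)))
  repeated : detℕ N U ≡ 0ℤ
  repeated with ℕP.<-cmp i p
  ... | tri< i<p _ _ = detℕ-equalRows N i p i<p p<N U same
  ... | tri≈ _ i≡p _ = ⊥-elim (i≢p i≡p)
  ... | tri> _ _ p<i = detℕ-equalRows N p i p<i i<N U (sym ∘ same)

detℕ-addTwoRows : ∀ N i p q → i ℕ.< N → p ℕ.< N → q ℕ.< N → i ≢ p → i ≢ q → ∀ E l m →
  detℕ N (setRow E i (λ c → E i c + l * E p c + m * E q c)) ≡ detℕ N E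
detℕ-addTwoRows N i p q i<N p<N q<N i≢p i≢q E l m =
  begin
    detℕ N (setRow E i (λ c → E i c + l * E p c + m * E q c))
  ≡⟨ detℕ-cong N (λ r c _ _ → trans (sym (setRow-twice E i _ _ r c)) (setRow-cong E′ i secondStep r c)) ⟩
    detℕ N (setRow E′ i (λ c → E′ i c + m * E′ q c))
  ≡⟨ detℕ-addRow N i q i<N q<N i≢q E′ m ⟩
    detℕ N E′
  ≡⟨ detℕ-addRow N i p i<N p<N i≢p E l ⟩
    detℕ N E
  ∎
  where
  open ≡-Reasoning
  E′ = setRow E i (λ c → E i c + l * E p c)
  secondStep : ∀ c → E i c + l * E p c + m * E q c ≡ E′ i c + m * E′ q c
  secondStep c = sym (cong₂ (λ x y → x + m * y) (setRow-at E i _ c) (setRow-other E i _ q c (i≢q ∘ sym)))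

detℕ-scaleRow : ∀ N i → i ℕ.< N → ∀ E (x : ℕ → ℤ) k →
  detℕ N (setRow E i (λ c → k * x c)) ≡ k * detℕ N (setRow E i x)
detℕ-scaleRow N i i<N E x k =
  trans (detℕ-cong N (λ r c _ _ → setRow-cong E i (λ c → pad k (x c)) r c))
 (trans (detℕ-linear N i i<N E x x k 0ℤ) (unpad k (detℕ N (setRow E i x))))
  where
  pad : ∀ k x → k * x ≡ k * x + 0ℤ * x
  pad = solve-∀
  unpad : ∀ k d → k * d + 0ℤ * d ≡ k * d
  unpad = solve-∀

-- Both expansions of the
-- (N+2)-determinant share the term E 0 0 · minor; the remaining terms are the
-- same double sum ∑ᵢ ∑ⱼ taken in the two possible orders.
detℕ-expandColumn : ∀ N E → detℕ (suc N) E ≡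
  ∑ (suc N) (λ i → sgn i * E i 0 * detℕ N (λ r c → E (punchInℕ i r) (suc c)))
detℕ-expandColumn zero    E = detℕ-expand zero E
detℕ-expandColumn (suc N) E =
  begin
    detℕ (suc (suc N)) E
  ≡⟨ detℕ-expand (suc N) E ⟩
    corner + ∑ (suc N) (λ j → sgn (suc j) * E 0 (suc j) * detℕ (suc N) (λ r c → E (suc r) (punchInℕ (suc j) c)))
  ≡⟨ cong (_+_ corner) (∑-cong (suc N) (λ j _ → byColumn j)) ⟩
    corner + ∑ (suc N) (λ j → ∑ (suc N) (λ i → term i j))
  ≡⟨ cong (_+_ corner) (sym (∑-comm (suc N) (suc N) term)) ⟩
    corner + ∑ (suc N) (λ i → ∑ (suc N) (λ j → term i j))
  ≡⟨ cong (_+_ corner) (sym (∑-cong (suc N) (λ i _ → byRow i))) ⟩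
    ∑ (suc (suc N)) (λ i → sgn i * E i 0 * detℕ (suc N) (λ r c → E (punchInℕ i r) (suc c)))
  ∎
  where
  open ≡-Reasoning
  corner = sgn 0 * E 0 0 * detℕ (suc N) (λ r c → E (suc r) (suc c))
  Y : ℕ → ℕ → ℤ
  Y i j = detℕ N (λ r c → E (suc (punchInℕ i r)) (suc (punchInℕ j c)))
  term : ℕ → ℕ → ℤ
  term i j = -1ℤ * sgn i * sgn j * E 0 (suc j) * E (suc i) 0 * Y i j
  byColumn : ∀ j → sgn (suc j) * E 0 (suc j) * detℕ (suc N) (λ r c → E (suc r) (punchInℕ (suc j) c))
                   ≡ ∑ (suc N) (λ i → term i j)
  byColumn j =
    trans (cong (λ t → sgn (suc j) * E 0 (suc j) * t) (detℕ-expandColumn N (λ r c → E (suc r) (punchInℕ (suc j) c))))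
   (trans (∑-*ˡ (suc N) (sgn (suc j) * E 0 (suc j)) (λ i → sgn i * E (suc i) 0 * Y i j))
          (∑-cong (suc N) (λ i _ → reorder (sgn j) (E 0 (suc j)) (sgn i) (E (suc i) 0) (Y i j))))
    where
    reorder : ∀ sj a si b y → -1ℤ * sj * a * (si * b * y) ≡ -1ℤ * si * sj * a * b * y
    reorder = solve-∀
  byRow : ∀ i → sgn (suc i) * E (suc i) 0 * detℕ (suc N) (λ r c → E (punchInℕ (suc i) r) (suc c))
                ≡ ∑ (suc N) (λ j → term i j)
  byRow i =
    trans (cong (λ t → sgn (suc i) * E (suc i) 0 * t) (detℕ-expand N (λ r c → E (punchInℕ (suc i) r) (suc c))))
   (trans (∑-*ˡ (suc N) (sgn (suc i) * E (suc i) 0) (λ j → sgn j * E 0 (suc j) * Y i j))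
          (∑-cong (suc N) (λ j _ → reorder (sgn i) (E (suc i) 0) (sgn j) (E 0 (suc j)) (Y i j))))
    where
    reorder : ∀ si b sj a y → -1ℤ * si * b * (sj * a * y) ≡ -1ℤ * si * sj * a * b * y
    reorder = solve-∀

detℕ-columnPivot : ∀ N E p → p ℕ.< suc N → (∀ i → i ℕ.< suc N → i ≢ p → E i 0 ≡ 0ℤ) →
  detℕ (suc N) E ≡ sgn p * E p 0 * detℕ N (λ r c → E (punchInℕ p r) (suc c))
detℕ-columnPivot N E p p<N zeros =
  trans (detℕ-expandColumn N E)
        (∑-single (suc N) _ p p<N (λ i i<N i≢p →
          trans (cong (λ t → sgn i * t * detℕ N (λ r c → E (punchInℕ i r) (suc c))) (zeros i i<N i≢p))
                (vanish (sgn i) _)))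
  where
  vanish : ∀ s d → s * 0ℤ * d ≡ 0ℤ
  vanish = solve-∀

Outside : ℕ → ℕ → ℕ → Set
Outside a K q = q ℕ.< a ⊎ a ℕ.+ K ≤ q

module RowBlock (N a K : ℕ) (E F : ℕ → ℕ → ℤ) where
  partial : ℕ → ℕ → ℕ → ℤ
  partial zero    = E
  partial (suc j) = setRow (partial j) (a ℕ.+ j) (F (a ℕ.+ j))

  partial-outside : ∀ j r c → Outside a j r → partial j r c ≡ E r c
  partial-outside zero    r c _ = refl
  partial-outside (suc j) r c (inj₁ r<a) =
    trans (setRow-other (partial j) (a ℕ.+ j) _ r c (λ r≡ → ℕP.<⇒≱ r<a (subst (a ≤_) (sym r≡) (ℕP.m≤m+n a j))))
          (partial-outside j r c (inj₁ r<a))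
  partial-outside (suc j) r c (inj₂ a+j+1≤r) =
    trans (setRow-other (partial j) (a ℕ.+ j) _ r c (λ r≡ → ℕP.<⇒≢ a+j<r (sym r≡)))
          (partial-outside j r c (inj₂ (ℕP.<⇒≤ a+j<r)))
    where
    a+j<r : a ℕ.+ j ℕ.< r
    a+j<r = subst (_≤ r) (ℕP.+-suc a j) a+j+1≤r

  partial-inside : ∀ j r c → a ≤ r → r ℕ.< a ℕ.+ j → partial j r c ≡ F r c
  partial-inside zero    r c a≤r r<a+0 = ⊥-elim (ℕP.<⇒≱ r<a+0 (subst (_≤ r) (sym (ℕP.+-identityʳ a)) a≤r))
  partial-inside (suc j) r c a≤r r<a+j+1 with ℕP.m<1+n⇒m<n∨m≡n (subst (r ℕ.<_) (ℕP.+-suc a j) r<a+j+1)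
  ... | inj₁ r<a+j = trans (setRow-other (partial j) (a ℕ.+ j) _ r c (ℕP.<⇒≢ r<a+j)) (partial-inside j r c a≤r r<a+j)
  ... | inj₂ refl  = setRow-at (partial j) (a ℕ.+ j) _ c

  complete : ∀ E′ → (∀ r c → a ≤ r → r ℕ.< a ℕ.+ K → E′ r c ≡ F r c) →
    (∀ r c → r ℕ.< N → Outside a K r → E′ r c ≡ E r c) → detℕ N E′ ≡ detℕ N (partial K)
  complete E′ inside outside = detℕ-cong N pointwise
    where
    pointwise : ∀ r c → r ℕ.< N → c ℕ.< N → E′ r c ≡ partial K r c
    pointwise r c r<N _ with r ℕP.<? a | r ℕP.<? a ℕ.+ K
    ... | yes r<a | _ = trans (outside r c r<N (inj₁ r<a)) (sym (partial-outside K r c (inj₁ r<a)))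
    ... | no r≮a | yes r<a+K = trans (inside r c (ℕP.≮⇒≥ r≮a) r<a+K) (sym (partial-inside K r c (ℕP.≮⇒≥ r≮a) r<a+K))
    ... | no _   | no r≮a+K = trans (outside r c r<N (inj₂ (ℕP.≮⇒≥ r≮a+K)))
                                    (sym (partial-outside K r c (inj₂ (ℕP.≮⇒≥ r≮a+K))))

  iterate : ∀ κ → (∀ j → suc j ≤ K → detℕ N (partial (suc j)) ≡ κ * detℕ N (partial j)) →
    detℕ N (partial K) ≡ κ ^ K * detℕ N E
  iterate κ step = go K ℕP.≤-refl
    where
    go : ∀ j → j ≤ K → detℕ N (partial j) ≡ κ ^ j * detℕ N E
    go zero    _      = sym (ℤP.*-identityˡ _)
    go (suc j) j+1≤K =
      trans (step j j+1≤K)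
     (trans (cong (κ *_) (go j (ℕP.<⇒≤ j+1≤K))) (sym (ℤP.*-assoc κ (κ ^ j) _)))

  block-< : a ℕ.+ K ≤ N → ∀ j → suc j ≤ K → a ℕ.+ j ℕ.< N
  block-< a+K≤N j j+1≤K = ℕP.<-≤-trans (ℕP.+-monoʳ-< a j+1≤K) a+K≤N

detℕ-scaleBlock : ∀ N a K → a ℕ.+ K ≤ N → ∀ E k E′ →
  (∀ r c → a ≤ r → r ℕ.< a ℕ.+ K → E′ r c ≡ k * E r c) →
  (∀ r c → r ℕ.< N → Outside a K r → E′ r c ≡ E r c) → detℕ N E′ ≡ k ^ K * detℕ N E
detℕ-scaleBlock N a K a+K≤N E k E′ inside outside =
  trans (complete E′ inside outside) (iterate k step)
  where
  open RowBlock N a K E (λ r c → k * E r c)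
  step : ∀ j → suc j ≤ K → detℕ N (partial (suc j)) ≡ k * detℕ N (partial j)
  step j j+1≤K =
    begin
      detℕ N (setRow (partial j) i (λ c → k * E i c))
    ≡⟨ detℕ-cong N (λ r c _ _ → setRow-cong (partial j) i
                     (λ c → cong (k *_) (sym (partial-outside j i c (inj₂ ℕP.≤-refl)))) r c) ⟩
      detℕ N (setRow (partial j) i (λ c → k * partial j i c))
    ≡⟨ detℕ-scaleRow N i (block-< a+K≤N j j+1≤K) (partial j) (partial j i) k ⟩
      k * detℕ N (setRow (partial j) i (partial j i))
    ≡⟨ cong (k *_) (detℕ-cong N (λ r c _ _ → setRow-self (partial j) i r c)) ⟩
      k * detℕ N (partial j)
    ∎
    where
    open ≡-Reasoning
    i = a ℕ.+ j

detℕ-addToBlock : ∀ N a K → a ℕ.+ K ≤ N → ∀ E (p₁ p₂ : ℕ → ℕ) (l₁ l₂ : ℕ → ℤ) →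
  (∀ r → a ≤ r → r ℕ.< a ℕ.+ K → Outside a K (p₁ r) × p₁ r ℕ.< N) →
  (∀ r → a ≤ r → r ℕ.< a ℕ.+ K → Outside a K (p₂ r) × p₂ r ℕ.< N) → ∀ E′ →
  (∀ r c → a ≤ r → r ℕ.< a ℕ.+ K → E′ r c ≡ E r c + l₁ r * E (p₁ r) c + l₂ r * E (p₂ r) c) →
  (∀ r c → r ℕ.< N → Outside a K r → E′ r c ≡ E r c) → detℕ N E′ ≡ detℕ N E
detℕ-addToBlock N a K a+K≤N E p₁ p₂ l₁ l₂ src₁ src₂ E′ inside outside =
  trans (complete E′ inside outside) (trans (iterate 1ℤ step) (trans (cong (_* detℕ N E) (ℤP.^-zeroˡ K)) (ℤP.*-identityˡ _)))
  where
  open RowBlock N a K E (λ r c → E r c + l₁ r * E (p₁ r) c + l₂ r * E (p₂ r) c)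
  stable : ∀ j q → suc j ≤ K → Outside a K q → Outside a j q × q ≢ a ℕ.+ j
  stable j q _     (inj₁ q<a) = inj₁ q<a , λ q≡ → ℕP.<⇒≱ q<a (subst (a ≤_) (sym q≡) (ℕP.m≤m+n a j))
  stable j q j+1≤K (inj₂ a+K≤q) = inj₂ (ℕP.≤-trans (ℕP.+-monoʳ-≤ a (ℕP.<⇒≤ j+1≤K)) a+K≤q) ,
                                  λ q≡ → ℕP.<⇒≢ (ℕP.<-≤-trans (ℕP.+-monoʳ-< a j+1≤K) a+K≤q) (sym q≡)
  step : ∀ j → suc j ≤ K → detℕ N (partial (suc j)) ≡ 1ℤ * detℕ N (partial j)
  step j j+1≤K =
    trans (detℕ-cong N (λ r c _ _ → setRow-cong M i current r c))
   (trans (detℕ-addTwoRows N i (p₁ i) (p₂ i) i<N (proj₂ src₁i) (proj₂ src₂i)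
                           (proj₂ s₁ ∘ sym) (proj₂ s₂ ∘ sym) M (l₁ i) (l₂ i))
          (sym (ℤP.*-identityˡ _)))
    where
    i = a ℕ.+ j
    M = partial j
    i<N : i ℕ.< N
    i<N = block-< a+K≤N j j+1≤K
    src₁i = src₁ i (ℕP.m≤m+n a j) (ℕP.+-monoʳ-< a j+1≤K)
    src₂i = src₂ i (ℕP.m≤m+n a j) (ℕP.+-monoʳ-< a j+1≤K)
    s₁ = stable j (p₁ i) j+1≤K (proj₁ src₁i)
    s₂ = stable j (p₂ i) j+1≤K (proj₁ src₂i)
    current : ∀ c → E i c + l₁ i * E (p₁ i) c + l₂ i * E (p₂ i) c ≡ M i c + l₁ i * M (p₁ i) c + l₂ i * M (p₂ i) c
    current c = sym (cong₂ (λ x y → x + l₂ i * y)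
      (cong₂ (λ x y → x + l₁ i * y) (partial-outside j i c (inj₂ ℕP.≤-refl)) (partial-outside j (p₁ i) c (proj₁ s₁)))
      (partial-outside j (p₂ i) c (proj₁ s₂)))

-- delay A s is the sequence A preceded by s zeros: a row of a Sylvester
-- matrix whose coefficient list A (leading coefficient first) starts in column s.
delay : (ℕ → ℤ) → ℕ → ℕ → ℤ
delay A zero    c       = A c
delay A (suc s) zero    = 0ℤ
delay A (suc s) (suc c) = delay A s c

delay-< : ∀ A s c → c ℕ.< s → delay A s c ≡ 0ℤ
delay-< A (suc s) zero    _         = refl
delay-< A (suc s) (suc c) (s≤s c<s) = delay-< A s c c<s

delay-≥ : ∀ A s c → s ≤ c → delay A s c ≡ A (c ℕ.∸ s)
delay-≥ A zero    c       _         = refl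
delay-≥ A (suc s) (suc c) (s≤s s≤c) = delay-≥ A s c s≤c

delay-cong : ∀ {A B : ℕ → ℤ} → (∀ k → A k ≡ B k) → ∀ s c → delay A s c ≡ delay B s c
delay-cong h zero    c       = h c
delay-cong h (suc s) zero    = refl
delay-cong h (suc s) (suc c) = delay-cong h s c

delay-scale : ∀ k A s c → delay (λ j → k * A j) s c ≡ k * delay A s c
delay-scale k A zero    c       = refl
delay-scale k A (suc s) zero    = sym (ℤP.*-zeroʳ k)
delay-scale k A (suc s) (suc c) = delay-scale k A s c

-- For
-- o₁ = o₂ = 0 this is the Sylvester matrix of the polynomials with leading-first
-- coefficient lists A and B (n = deg B); the offsets describe its minors.
Syl : (ℕ → ℤ) → ℕ → (ℕ → ℤ) → ℕ → ℕ → ℕ → ℕ → ℤ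
Syl A o₁ B o₂ n r c with r ℕ.<ᵇ n
... | true  = delay A (r ℕ.+ o₁) c
... | false = delay B ((r ℕ.∸ n) ℕ.+ o₂) c

Syl-upper : ∀ A o₁ B o₂ n r c → r ℕ.< n → Syl A o₁ B o₂ n r c ≡ delay A (r ℕ.+ o₁) c
Syl-upper A o₁ B o₂ n r c r<n with r ℕ.<ᵇ n | ℕP.<⇒<ᵇ r<n
... | true | _ = refl

Syl-lower : ∀ A o₁ B o₂ n r c → n ≤ r → Syl A o₁ B o₂ n r c ≡ delay B ((r ℕ.∸ n) ℕ.+ o₂) c
Syl-lower A o₁ B o₂ n r c n≤r with r ℕ.<ᵇ n in eq
... | true  = ⊥-elim (ℕP.<⇒≱ (ℕP.<ᵇ⇒< r n (subst T (sym eq) _)) n≤r)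
... | false = refl

Syl-cong : ∀ {A A′ B B′} o₁ o₂ n → (∀ k → A k ≡ A′ k) → (∀ k → B k ≡ B′ k) →
  ∀ r c → Syl A o₁ B o₂ n r c ≡ Syl A′ o₁ B′ o₂ n r c
Syl-cong o₁ o₂ n hA hB r c with r ℕ.<ᵇ n
... | true  = delay-cong hA (r ℕ.+ o₁) c
... | false = delay-cong hB (r ℕ.∸ n ℕ.+ o₂) c

-- If the A-rows all start after column 0, the first column of the matrix has
-- the single nonzero entry B 0 in row n; deleting that row and column leaves
-- the same shape with o₁ decreased by one.
Syl-pivotLower : ∀ N n o₁ A B → n ≤ N →
  detℕ (suc N) (Syl A (suc o₁) B 0 n) ≡ sgn n * B 0 * detℕ N (Syl A o₁ B 0 n)
Syl-pivotLower N n o₁ A B n≤N =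
  trans (detℕ-columnPivot N E n (s≤s n≤N) zeros)
        (cong₂ (λ x y → sgn n * x * y) pivot (detℕ-cong N minor))
  where
  E = Syl A (suc o₁) B 0 n
  zeros : ∀ i → i ℕ.< suc N → i ≢ n → E i 0 ≡ 0ℤ
  zeros i _ i≢n with ℕP.<-cmp i n
  ... | tri< i<n _ _ = trans (Syl-upper A (suc o₁) B 0 n i 0 i<n)
                             (delay-< A (i ℕ.+ suc o₁) 0 (subst (0 ℕ.<_) (sym (ℕP.+-suc i o₁)) (s≤s z≤n)))
  ... | tri≈ _ i≡n _ = ⊥-elim (i≢n i≡n)
  ... | tri> _ _ n<i = trans (Syl-lower A (suc o₁) B 0 n i 0 (ℕP.<⇒≤ n<i))
                             (delay-< B (i ℕ.∸ n ℕ.+ 0) 0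
                                (subst (0 ℕ.<_) (sym (ℕP.+-identityʳ (i ℕ.∸ n))) (ℕP.m<n⇒0<n∸m n<i)))
  pivot : E n 0 ≡ B 0
  pivot = trans (Syl-lower A (suc o₁) B 0 n n 0 ℕP.≤-refl) (cong (λ t → delay B (t ℕ.+ 0) 0) (ℕP.n∸n≡0 n))
  lowerMinor : ∀ r c → n ≤ r → E (punchInℕ n r) (suc c) ≡ Syl A o₁ B 0 n r c
  lowerMinor r c n≤r =
    trans (cong (λ t → E t (suc c)) (punchInℕ-≥ n r n≤r))
   (trans (Syl-lower A (suc o₁) B 0 n (suc r) (suc c) (ℕP.m≤n⇒m≤1+n n≤r))
   (trans (cong (λ t → delay B (t ℕ.+ 0) (suc c)) (ℕP.+-∸-assoc 1 n≤r))
          (sym (Syl-lower A o₁ B 0 n r c n≤r))))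
  minor : ∀ r c → r ℕ.< N → c ℕ.< N → E (punchInℕ n r) (suc c) ≡ Syl A o₁ B 0 n r c
  minor r c _ _ with r ℕP.<? n
  ... | yes r<n =
    trans (cong (λ t → E t (suc c)) (punchInℕ-< n r r<n))
   (trans (Syl-upper A (suc o₁) B 0 n r (suc c) r<n)
   (trans (cong (λ t → delay A t (suc c)) (ℕP.+-suc r o₁))
          (sym (Syl-upper A o₁ B 0 n r c r<n))))
  ... | no r≮n = lowerMinor r c (ℕP.≮⇒≥ r≮n)

-- Symmetrically, if the B-rows all start after column 0, the only nonzero
-- entry of the first column is A 0 in row 0.
Syl-pivotUpper : ∀ N n o₂ A B →
  detℕ (suc N) (Syl A 0 B (suc o₂) (suc n)) ≡ A 0 * detℕ N (Syl A 0 B o₂ n)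
Syl-pivotUpper N n o₂ A B =
  trans (detℕ-columnPivot N E 0 (s≤s z≤n) zeros)
 (trans (cong₂ (λ x y → 1ℤ * x * y) (Syl-upper A 0 B (suc o₂) (suc n) 0 0 (s≤s z≤n)) (detℕ-cong N minor))
        (cong (_* detℕ N (Syl A 0 B o₂ n)) (ℤP.*-identityˡ (A 0))))
  where
  E = Syl A 0 B (suc o₂) (suc n)
  lowerRow : ∀ r c → n ≤ r → E (suc r) c ≡ delay B (suc ((r ℕ.∸ n) ℕ.+ o₂)) c
  lowerRow r c n≤r = trans (Syl-lower A 0 B (suc o₂) (suc n) (suc r) c (s≤s n≤r))
                           (cong (λ t → delay B t c) (ℕP.+-suc (r ℕ.∸ n) o₂))
  zeros : ∀ i → i ℕ.< suc N → i ≢ 0 → E i 0 ≡ 0ℤ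
  zeros zero    _ i≢0 = ⊥-elim (i≢0 refl)
  zeros (suc i) _ _   with i ℕP.<? n
  ... | yes i<n = Syl-upper A 0 B (suc o₂) (suc n) (suc i) 0 (s≤s i<n)
  ... | no i≮n  = lowerRow i 0 (ℕP.≮⇒≥ i≮n)
  minor : ∀ r c → r ℕ.< N → c ℕ.< N → E (suc r) (suc c) ≡ Syl A 0 B o₂ n r c
  minor r c _ _ with r ℕP.<? n
  ... | yes r<n = trans (Syl-upper A 0 B (suc o₂) (suc n) (suc r) (suc c) (s≤s r<n)) (sym (Syl-upper A 0 B o₂ n r c r<n))
  ... | no r≮n  = trans (lowerRow r (suc c) (ℕP.≮⇒≥ r≮n)) (sym (Syl-lower A 0 B o₂ n r c (ℕP.≮⇒≥ r≮n)))

sgn-square : ∀ n → sgn n * sgn n ≡ 1ℤ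
sgn-square zero    = refl
sgn-square (suc n) = trans (swap-signs (sgn n)) (sgn-square n)
  where
  swap-signs : ∀ s → -1ℤ * s * (-1ℤ * s) ≡ s * s
  swap-signs = solve-∀

-- ThreeTerm F G H α e says F = (α x + e) G + H for the polynomials with
-- leading-first coefficient lists F, G, H of degrees d + 2, d + 1, d.
ThreeTerm : (F G H : ℕ → ℤ) → ℤ → ℤ → Set
ThreeTerm F G H α e = ∀ k → F k ≡ α * G k + e * delay G 1 k + delay H 2 k

threeTerm-rows : ∀ F G H α e → ThreeTerm F G H α e →
  ∀ r c → delay H (r ℕ.+ 2) c ≡ delay F r c + - α * delay G r c + - e * delay G (suc r) c
threeTerm-rows F G H α e rel zero c =
  trans (solveH (delay H 2 c) α e (G c) (delay G 1 c)) (cong (λ t → t + - α * G c + - e * delay G 1 c) (sym (rel c)))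
  where
  solveH : ∀ h α e g g′ → h ≡ (α * g + e * g′ + h) + - α * g + - e * g′
  solveH = solve-∀
threeTerm-rows F G H α e rel (suc r) zero = zeros α e
  where
  zeros : ∀ α e → 0ℤ ≡ 0ℤ + - α * 0ℤ + - e * 0ℤ
  zeros = solve-∀
threeTerm-rows F G H α e rel (suc r) (suc c) = threeTerm-rows F G H α e rel r c

-- Elimination in the upper block: if F = (α x + e) G + H, subtracting from
-- each F-row the right combination of two G-rows turns it into an H-row
-- delayed by two more columns.
Syl-reduceUpperRows : ∀ M n F G H α e → ThreeTerm F G H α e → n ℕ.+ n ℕ.< M →
  detℕ M (Syl F 0 G 0 n) ≡ detℕ M (Syl H 2 G 0 n)
Syl-reduceUpperRows M n F G H α e rel 2n<M =
  sym (detℕ-addToBlock M 0 n n≤M E (n ℕ.+_) (λ r → n ℕ.+ suc r) (λ _ → - α) (λ _ → - e) src₁ src₂ E′ inside outside)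
  where
  E = Syl F 0 G 0 n
  E′ = Syl H 2 G 0 n
  n≤M : n ≤ M
  n≤M = ℕP.≤-trans (ℕP.m≤m+n n n) (ℕP.<⇒≤ 2n<M)
  src₁ : ∀ r → 0 ≤ r → r ℕ.< n → Outside 0 n (n ℕ.+ r) × n ℕ.+ r ℕ.< M
  src₁ r _ r<n = inj₂ (ℕP.m≤m+n n r) , ℕP.<-trans (ℕP.+-monoʳ-< n r<n) 2n<M
  src₂ : ∀ r → 0 ≤ r → r ℕ.< n → Outside 0 n (n ℕ.+ suc r) × n ℕ.+ suc r ℕ.< M
  src₂ r _ r<n = inj₂ (ℕP.m≤m+n n (suc r)) , ℕP.≤-<-trans (ℕP.+-monoʳ-≤ n r<n) 2n<M
  lowerRow : ∀ t c → E (n ℕ.+ t) c ≡ delay G t c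
  lowerRow t c = trans (Syl-lower F 0 G 0 n (n ℕ.+ t) c (ℕP.m≤m+n n t))
                       (cong (λ x → delay G x c) (trans (ℕP.+-identityʳ _) (ℕP.m+n∸m≡n n t)))
  inside : ∀ r c → 0 ≤ r → r ℕ.< n → E′ r c ≡ E r c + - α * E (n ℕ.+ r) c + - e * E (n ℕ.+ suc r) c
  inside r c _ r<n =
    begin
      E′ r c
    ≡⟨ Syl-upper H 2 G 0 n r c r<n ⟩
      delay H (r ℕ.+ 2) c
    ≡⟨ threeTerm-rows F G H α e rel r c ⟩
      delay F r c + - α * delay G r c + - e * delay G (suc r) c
    ≡⟨ cong (λ z → delay F r c + - α * delay G r c + - e * z) (sym (lowerRow (suc r) c)) ⟩
      delay F r c + - α * delay G r c + - e * E (n ℕ.+ suc r) c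
    ≡⟨ sym (cong₂ (λ x y → x + - α * y + - e * E (n ℕ.+ suc r) c) upperRow (lowerRow r c)) ⟩
      E r c + - α * E (n ℕ.+ r) c + - e * E (n ℕ.+ suc r) c
    ∎
    where
    open ≡-Reasoning
    upperRow : E r c ≡ delay F r c
    upperRow = trans (Syl-upper F 0 G 0 n r c r<n) (cong (λ x → delay F x c) (ℕP.+-identityʳ r))
  outside : ∀ r c → r ℕ.< M → Outside 0 n r → E′ r c ≡ E r c
  outside r c _ (inj₂ n≤r) = trans (Syl-lower H 2 G 0 n r c n≤r) (sym (Syl-lower F 0 G 0 n r c n≤r))

below-half : ∀ {m r M} → m ≤ r → r ℕ.< M → M ℕ.< m ℕ.+ m → suc (r ℕ.∸ m) ℕ.< m
below-half {zero}  _   _   M<0  = ⊥-elim (ℕP.<⇒≱ M<0 z≤n)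
below-half {suc k} {r} m≤r r<M M<2m =
  subst (ℕ._< suc k) (ℕP.+-∸-assoc 1 m≤r) (ℕP.m<n+o⇒m∸n<o (suc r) (suc k) (ℕP.<-≤-trans (s≤s r<M) M<2m))

-- Elimination in the lower block: if G = (α x + e) H + K and every G-row has
-- two H-rows above it to combine with (M < 2m), the G-rows become K-rows.
Syl-reduceLowerRows : ∀ M m G H K α e → ThreeTerm G H K α e → m ≤ M → M ℕ.< m ℕ.+ m →
  detℕ M (Syl H 0 G 0 m) ≡ detℕ M (Syl H 0 K 2 m)
Syl-reduceLowerRows M m G H K α e rel m≤M M<2m =
  sym (detℕ-addToBlock M m (M ℕ.∸ m) m+k≤M E (ℕ._∸ m) (λ r → suc (r ℕ.∸ m)) (λ _ → - α) (λ _ → - e)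
                       src₁ src₂ E′ inside outside)
  where
  E = Syl H 0 G 0 m
  E′ = Syl H 0 K 2 m
  m+k≡M : m ℕ.+ (M ℕ.∸ m) ≡ M
  m+k≡M = ℕP.m+[n∸m]≡n m≤M
  m+k≤M : m ℕ.+ (M ℕ.∸ m) ≤ M
  m+k≤M = ℕP.≤-reflexive m+k≡M
  source-< : ∀ r → m ≤ r → r ℕ.< m ℕ.+ (M ℕ.∸ m) → suc (r ℕ.∸ m) ℕ.< m
  source-< r m≤r r<M′ = below-half m≤r (subst (r ℕ.<_) m+k≡M r<M′) M<2m
  src₁ : ∀ r → m ≤ r → r ℕ.< m ℕ.+ (M ℕ.∸ m) → Outside m (M ℕ.∸ m) (r ℕ.∸ m) × r ℕ.∸ m ℕ.< M
  src₁ r m≤r r< = inj₁ (ℕP.<⇒≤ (source-< r m≤r r<)) ,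
                  ℕP.<-≤-trans (ℕP.<⇒≤ (source-< r m≤r r<)) m≤M
  src₂ : ∀ r → m ≤ r → r ℕ.< m ℕ.+ (M ℕ.∸ m) → Outside m (M ℕ.∸ m) (suc (r ℕ.∸ m)) × suc (r ℕ.∸ m) ℕ.< M
  src₂ r m≤r r< = inj₁ (source-< r m≤r r<) , ℕP.<-≤-trans (source-< r m≤r r<) m≤M
  upperRow : ∀ t c → t ℕ.< m → E t c ≡ delay H t c
  upperRow t c t<m = trans (Syl-upper H 0 G 0 m t c t<m) (cong (λ x → delay H x c) (ℕP.+-identityʳ t))
  inside : ∀ r c → m ≤ r → r ℕ.< m ℕ.+ (M ℕ.∸ m) →
    E′ r c ≡ E r c + - α * E (r ℕ.∸ m) c + - e * E (suc (r ℕ.∸ m)) c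
  inside r c m≤r r< =
    begin
      E′ r c
    ≡⟨ Syl-lower H 0 K 2 m r c m≤r ⟩
      delay K (t ℕ.+ 2) c
    ≡⟨ threeTerm-rows G H K α e rel t c ⟩
      delay G t c + - α * delay H t c + - e * delay H (suc t) c
    ≡⟨ cong (λ z → delay G t c + - α * delay H t c + - e * z) (sym (upperRow (suc t) c t+1<m)) ⟩
      delay G t c + - α * delay H t c + - e * E (suc t) c
    ≡⟨ sym (cong₂ (λ x y → x + - α * y + - e * E (suc t) c) lowerRow (upperRow t c (ℕP.<⇒≤ t+1<m))) ⟩
      E r c + - α * E t c + - e * E (suc t) c
    ∎
    where
    open ≡-Reasoning
    t = r ℕ.∸ m
    t+1<m : suc t ℕ.< m
    t+1<m = source-< r m≤r r<
    lowerRow : E r c ≡ delay G t c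
    lowerRow = trans (Syl-lower H 0 G 0 m r c m≤r) (cong (λ x → delay G x c) (ℕP.+-identityʳ t))
  outside : ∀ r c → r ℕ.< M → Outside m (M ℕ.∸ m) r → E′ r c ≡ E r c
  outside r c _   (inj₁ r<m) = trans (Syl-upper H 0 K 2 m r c r<m) (sym (Syl-upper H 0 G 0 m r c r<m))
  outside r c r<M (inj₂ M≤r) = ⊥-elim (ℕP.<⇒≱ r<M (subst (_≤ r) m+k≡M M≤r))

-- Res(F, G) = lead(G)² · Res(H, G) when F = (α x + e) G + H: eliminate, then
-- expand twice along the first column.
Syl-eliminateUpper : ∀ N n F G H α e → ThreeTerm F G H α e → n ≤ N → n ℕ.+ n ≤ suc N →
  detℕ (suc (suc N)) (Syl F 0 G 0 n) ≡ G 0 * G 0 * detℕ N (Syl H 0 G 0 n)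
Syl-eliminateUpper N n F G H α e rel n≤N 2n≤N+1 =
  begin
    detℕ (suc (suc N)) (Syl F 0 G 0 n)
  ≡⟨ Syl-reduceUpperRows (suc (suc N)) n F G H α e rel (s≤s 2n≤N+1) ⟩
    detℕ (suc (suc N)) (Syl H 2 G 0 n)
  ≡⟨ Syl-pivotLower (suc N) n 1 H G (ℕP.m≤n⇒m≤1+n n≤N) ⟩
    sgn n * G 0 * detℕ (suc N) (Syl H 1 G 0 n)
  ≡⟨ cong (λ t → sgn n * G 0 * t) (Syl-pivotLower N n 0 H G n≤N) ⟩
    sgn n * G 0 * (sgn n * G 0 * detℕ N (Syl H 0 G 0 n))
  ≡⟨ regroup (sgn n) (G 0) (detℕ N (Syl H 0 G 0 n)) ⟩
    sgn n * sgn n * (G 0 * G 0 * detℕ N (Syl H 0 G 0 n))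
  ≡⟨ trans (cong (_* (G 0 * G 0 * detℕ N (Syl H 0 G 0 n))) (sgn-square n)) (ℤP.*-identityˡ _) ⟩
    G 0 * G 0 * detℕ N (Syl H 0 G 0 n)
  ∎
  where
  open ≡-Reasoning
  regroup : ∀ s g d → s * g * (s * g * d) ≡ s * s * (g * g * d)
  regroup = solve-∀

Syl-eliminateLower : ∀ N n G H K α e → ThreeTerm G H K α e → n ≤ N → N ≤ n ℕ.+ suc n →
  detℕ (suc (suc N)) (Syl H 0 G 0 (suc (suc n))) ≡ H 0 * H 0 * detℕ N (Syl H 0 K 0 n)
Syl-eliminateLower N n G H K α e rel n≤N N≤2n+1 =
  begin
    detℕ (suc (suc N)) (Syl H 0 G 0 (suc (suc n)))
  ≡⟨ Syl-reduceLowerRows (suc (suc N)) (suc (suc n)) G H K α e rel (s≤s (s≤s n≤N)) N+2<2n+4 ⟩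
    detℕ (suc (suc N)) (Syl H 0 K 2 (suc (suc n)))
  ≡⟨ Syl-pivotUpper (suc N) (suc n) 1 H K ⟩
    H 0 * detℕ (suc N) (Syl H 0 K 1 (suc n))
  ≡⟨ cong (H 0 *_) (Syl-pivotUpper N n 0 H K) ⟩
    H 0 * (H 0 * detℕ N (Syl H 0 K 0 n))
  ≡⟨ sym (ℤP.*-assoc (H 0) (H 0) _) ⟩
    H 0 * H 0 * detℕ N (Syl H 0 K 0 n)
  ∎
  where
  open ≡-Reasoning
  N+2<2n+4 : suc (suc N) ℕ.< suc (suc n) ℕ.+ suc (suc n)
  N+2<2n+4 = s≤s (s≤s (subst (suc N ≤_) (sym (ℕP.+-suc n (suc n))) (s≤s N≤2n+1)))

-- Scaling one of the two polynomials scales the resultant by a power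
-- (the number of rows it occupies).
Syl-scaleUpper : ∀ N n A B k → n ≤ N →
  detℕ N (Syl (λ j → k * A j) 0 B 0 n) ≡ k ^ n * detℕ N (Syl A 0 B 0 n)
Syl-scaleUpper N n A B k n≤N =
  detℕ-scaleBlock N 0 n n≤N (Syl A 0 B 0 n) k (Syl (λ j → k * A j) 0 B 0 n) inside outside
  where
  inside : ∀ r c → 0 ≤ r → r ℕ.< n → Syl (λ j → k * A j) 0 B 0 n r c ≡ k * Syl A 0 B 0 n r c
  inside r c _ r<n = trans (Syl-upper _ 0 B 0 n r c r<n)
                    (trans (delay-scale k A (r ℕ.+ 0) c) (cong (k *_) (sym (Syl-upper A 0 B 0 n r c r<n))))
  outside : ∀ r c → r ℕ.< N → Outside 0 n r → Syl (λ j → k * A j) 0 B 0 n r c ≡ Syl A 0 B 0 n r c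
  outside r c _ (inj₂ n≤r) = trans (Syl-lower _ 0 B 0 n r c n≤r) (sym (Syl-lower A 0 B 0 n r c n≤r))

Syl-scaleLower : ∀ N n A B k → n ≤ N →
  detℕ N (Syl A 0 (λ j → k * B j) 0 n) ≡ k ^ (N ℕ.∸ n) * detℕ N (Syl A 0 B 0 n)
Syl-scaleLower N n A B k n≤N =
  detℕ-scaleBlock N n (N ℕ.∸ n) (ℕP.≤-reflexive n+k≡N) (Syl A 0 B 0 n) k (Syl A 0 (λ j → k * B j) 0 n) inside outside
  where
  n+k≡N : n ℕ.+ (N ℕ.∸ n) ≡ N
  n+k≡N = ℕP.m+[n∸m]≡n n≤N
  inside : ∀ r c → n ≤ r → r ℕ.< n ℕ.+ (N ℕ.∸ n) → Syl A 0 (λ j → k * B j) 0 n r c ≡ k * Syl A 0 B 0 n r c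
  inside r c n≤r _ = trans (Syl-lower A 0 _ 0 n r c n≤r)
                    (trans (delay-scale k B (r ℕ.∸ n ℕ.+ 0) c) (cong (k *_) (sym (Syl-lower A 0 B 0 n r c n≤r))))
  outside : ∀ r c → r ℕ.< N → Outside n (N ℕ.∸ n) r → Syl A 0 (λ j → k * B j) 0 n r c ≡ Syl A 0 B 0 n r c
  outside r c _   (inj₁ r<n) = trans (Syl-upper A 0 _ 0 n r c r<n) (sym (Syl-upper A 0 B 0 n r c r<n))
  outside r c r<N (inj₂ N≤r) = ⊥-elim (ℕP.<⇒≱ r<N (subst (_≤ r) n+k≡N N≤r))

-- Polynomials are handled as coefficient lists applyUpTo h (d + 1) = [h 0, …, h d].
applyUpTo-cong : ∀ {f g : ℕ → ℤ} → (∀ i → f i ≡ g i) → ∀ n → applyUpTo f n ≡ applyUpTo g n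
applyUpTo-cong h zero    = refl
applyUpTo-cong h (suc n) = cong₂ _∷_ (h 0) (applyUpTo-cong (λ i → h (suc i)) n)

tab≡applyUpTo : ∀ k t → tab k t ≡ applyUpTo t (suc k)
tab≡applyUpTo k t = LP.map-upTo t (suc k)

normalize-∷ʳ : ∀ xs z → z ≢ 0ℤ → normalize (xs ∷ʳ z) ≡ xs ∷ʳ z
normalize-∷ʳ xs z z≢0 =
  begin
    reverse (L.dropWhileᵇ isZero (reverse (xs ∷ʳ z)))
  ≡⟨ cong (λ t → reverse (L.dropWhileᵇ isZero t)) (LP.reverse-++ xs (z ∷ [])) ⟩
    reverse (L.dropWhileᵇ isZero (z ∷ reverse xs))
  ≡⟨ cong reverse (keep z z≢0) ⟩
    reverse (z ∷ reverse xs)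
  ≡⟨ LP.unfold-reverse z (reverse xs) ⟩
    reverse (reverse xs) ∷ʳ z
  ≡⟨ cong (_∷ʳ z) (LP.reverse-involutive xs) ⟩
    xs ∷ʳ z
  ∎
  where
  open ≡-Reasoning
  keep : ∀ z → z ≢ 0ℤ → L.dropWhileᵇ isZero (z ∷ reverse xs) ≡ z ∷ reverse xs
  keep (+ zero)  z≢0 = ⊥-elim (z≢0 refl)
  keep (+ suc n) _   = refl
  keep -[1+ n ]  _   = refl

normalize-applyUpTo : ∀ (h : ℕ → ℤ) d → h d ≢ 0ℤ → normalize (applyUpTo h (suc d)) ≡ applyUpTo h (suc d)
normalize-applyUpTo h d hd≢0 =
  trans (cong normalize (sym (LP.applyUpTo-∷ʳ h d)))
        (trans (normalize-∷ʳ (applyUpTo h d) (h d) hd≢0) (LP.applyUpTo-∷ʳ h d))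

degree-applyUpTo : ∀ (h : ℕ → ℤ) d → degree (applyUpTo h (suc d)) ≡ d
degree-applyUpTo h d = cong (ℕ._∸ 1) (LP.length-applyUpTo h (suc d))

coef-applyUpTo : ∀ (h : ℕ → ℤ) n i → i ℕ.< n → coef (applyUpTo h n) i ≡ h i
coef-applyUpTo h (suc n) zero    _         = refl
coef-applyUpTo h (suc n) (suc i) (s≤s i<n) = coef-applyUpTo (λ j → h (suc j)) n i i<n

lead-applyUpTo : ∀ (h : ℕ → ℤ) d → lead (applyUpTo h (suc d)) ≡ h d
lead-applyUpTo h d = trans (cong (coef (applyUpTo h (suc d))) (degree-applyUpTo h d))
                           (coef-applyUpTo h (suc d) d (ℕP.n<1+n d))

derivAux-applyUpTo : ∀ k (g : ℕ → ℤ) n → derivAux k (applyUpTo g n) ≡ applyUpTo (λ i → + (k ℕ.+ i) * g i) n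
derivAux-applyUpTo k g zero    = refl
derivAux-applyUpTo k g (suc n) =
  cong₂ _∷_ (cong (λ t → + t * g 0) (sym (ℕP.+-identityʳ k)))
            (trans (derivAux-applyUpTo (suc k) (λ i → g (suc i)) n)
                   (applyUpTo-cong (λ i → cong (λ t → + t * g (suc i)) (sym (ℕP.+-suc k i))) n))

derivative : (ℕ → ℤ) → ℕ → ℤ
derivative h i = + suc i * h (suc i)

deriv-applyUpTo : ∀ (h : ℕ → ℤ) d → deriv (applyUpTo h (suc d)) ≡ applyUpTo (derivative h) d
deriv-applyUpTo h d = derivAux-applyUpTo 1 (λ i → h (suc i)) d

-- leadingFirst f d k is the coefficient of x^(d - k) in f (zero for k > d):
-- the coefficient list of a degree-d polynomial read from the top.
leadingFirst : Poly → ℕ → ℕ → ℤ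
leadingFirst f d k with d ℕ.<ᵇ k
... | true  = 0ℤ
... | false = coef f (d ℕ.∸ k)

leadingFirst-> : ∀ f d k → d ℕ.< k → leadingFirst f d k ≡ 0ℤ
leadingFirst-> f d k d<k with d ℕ.<ᵇ k | ℕP.<⇒<ᵇ d<k
... | true | _ = refl

leadingFirst-≤ : ∀ f d k → k ≤ d → leadingFirst f d k ≡ coef f (d ℕ.∸ k)
leadingFirst-≤ f d k k≤d with d ℕ.<ᵇ k in eq
... | true  = ⊥-elim (ℕP.<⇒≱ (ℕP.<ᵇ⇒< d k (subst T (sym eq) _)) k≤d)
... | false = refl

leadingFirst-applyUpTo : ∀ (h g : ℕ → ℤ) d →
  (∀ k → k ≤ d → h (d ℕ.∸ k) ≡ g k) → (∀ k → d ℕ.< k → g k ≡ 0ℤ) →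
  ∀ k → leadingFirst (applyUpTo h (suc d)) d k ≡ g k
leadingFirst-applyUpTo h g d inRange beyond k with k ℕP.≤? d
... | yes k≤d = trans (leadingFirst-≤ _ d k k≤d)
                      (trans (coef-applyUpTo h (suc d) (d ℕ.∸ k) (s≤s (ℕP.m∸n≤m d k))) (inRange k k≤d))
... | no k≰d  = trans (leadingFirst-> _ d k (ℕP.≰⇒> k≰d)) (sym (beyond k (ℕP.≰⇒> k≰d)))

shiftedEntry≡delay : ∀ a d s c → shiftedEntry a d s c ≡ delay (leadingFirst a d) s c
shiftedEntry≡delay a d s c with c ℕ.<ᵇ s in c<s | d ℕ.<ᵇ (c ℕ.∸ s) in d<c-s
... | true  | _     = sym (delay-< _ s c (ℕP.<ᵇ⇒< c s (subst T (sym c<s) _)))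
... | false | true  = sym (trans (delay-≥ _ s c s≤c) (leadingFirst-> a d (c ℕ.∸ s) (ℕP.<ᵇ⇒< d _ (subst T (sym d<c-s) _))))
  where
  s≤c : s ≤ c
  s≤c = ℕP.≮⇒≥ (λ lt → subst T c<s (ℕP.<⇒<ᵇ lt))
... | false | false = sym (trans (delay-≥ _ s c s≤c) (leadingFirst-≤ a d (c ℕ.∸ s) c-s≤d))
  where
  s≤c : s ≤ c
  s≤c = ℕP.≮⇒≥ (λ lt → subst T c<s (ℕP.<⇒<ᵇ lt))
  c-s≤d : c ℕ.∸ s ≤ d
  c-s≤d = ℕP.≮⇒≥ (λ lt → subst T d<c-s (ℕP.<⇒<ᵇ lt))

sylvester≡Syl : ∀ f m g n (r c : Fin (n ℕ.+ m)) →
  sylvester f m g n r c ≡ Syl (leadingFirst f m) 0 (leadingFirst g n) 0 n (toℕ r) (toℕ c)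
sylvester≡Syl f m g n r c with toℕ r ℕ.<ᵇ n
... | true  = trans (shiftedEntry≡delay f m (toℕ r) (toℕ c))
                    (cong (λ t → delay (leadingFirst f m) t (toℕ c)) (sym (ℕP.+-identityʳ (toℕ r))))
... | false = trans (shiftedEntry≡delay g n (toℕ r ℕ.∸ n) (toℕ c))
                    (cong (λ t → delay (leadingFirst g n) t (toℕ c)) (sym (ℕP.+-identityʳ (toℕ r ℕ.∸ n))))

resultant≡detSyl : ∀ f g → resultant f g ≡
  detℕ (degree g ℕ.+ degree f) (Syl (leadingFirst f (degree f)) 0 (leadingFirst g (degree g)) 0 (degree g))
resultant≡detSyl f g = det-cong _ (sylvester≡Syl f (degree f) g (degree g))

/ℕ1 : ∀ x → x ℤ./ℕ 1 ≡ x
/ℕ1 (+ n)      = cong +_ (ℕDM.n/1≡n n)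
/ℕ1 -[1+ n ] with suc n ℕ.% 1 | ℕDM.n%1≡0 (suc n)
... | zero | _ = cong -_ (cong +_ (ℕDM.n/1≡n (suc n)))

/-unit : ∀ x a .{{_ : ℤ.NonZero a}} → a * a ≡ 1ℤ → (x ℤ./ a) ≡ a * x
/-unit x (+ suc zero)    _ = cong (1ℤ *_) (/ℕ1 x)
/-unit x -[1+ zero ]     _ = cong (-1ℤ *_) (/ℕ1 x)
/-unit x (+ suc (suc n)) ()
/-unit x -[1+ suc n ]    ()

disc-unitLead : ∀ f → normalize f ≡ f → lead f * lead f ≡ 1ℤ →
  disc f ≡ lead f * (sgn ((degree f ℕ.* (degree f ℕ.∸ 1)) ℕ./ 2) * resultant f (normalize (deriv f)))
disc-unitLead f normal unit = trans (cong (λ g → discAux g (lead g)) normal) (byLead (lead f) unit)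
  where
  byLead : ∀ a → a * a ≡ 1ℤ →
    discAux f a ≡ a * (sgn ((degree f ℕ.* (degree f ℕ.∸ 1)) ℕ./ 2) * resultant f (normalize (deriv f)))
  byLead (+ zero)     ()
  byLead a@(+[1+ _ ]) a²≡1 = /-unit _ a a²≡1
  byLead a@(-[1+ _ ]) a²≡1 = /-unit _ a a²≡1

unit≢0 : ∀ {a} → a * a ≡ 1ℤ → a ≢ 0ℤ
unit≢0 a²≡1 refl with a²≡1
... | ()

disc-applyUpTo : ∀ h d → h (suc d) * h (suc d) ≡ 1ℤ →
  disc (applyUpTo h (suc (suc d))) ≡ h (suc d) * (sgn ((suc d ℕ.* (suc d ℕ.∸ 1)) ℕ./ 2) *
    detℕ (d ℕ.+ suc d) (Syl (leadingFirst (applyUpTo h (suc (suc d))) (suc d)) 0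
                            (leadingFirst (applyUpTo (derivative h) (suc d)) d) 0 d))
disc-applyUpTo h d ℓ²≡1 =
  begin
    disc L
  ≡⟨ disc-unitLead L (normalize-applyUpTo h (suc d) ℓ≢0) (trans (cong (λ x → x * x) leadL) ℓ²≡1) ⟩
    lead L * (sgn ((degree L ℕ.* (degree L ℕ.∸ 1)) ℕ./ 2) * resultant L (normalize (deriv L)))
  ≡⟨ cong₂ (λ x e → x * (sgn ((e ℕ.* (e ℕ.∸ 1)) ℕ./ 2) * resultant L (normalize (deriv L))))
           leadL (degree-applyUpTo h (suc d)) ⟩
    ℓ * (sgn s * resultant L (normalize (deriv L)))
  ≡⟨ cong (λ y → ℓ * (sgn s * y)) (trans (cong (resultant L) derivL) (resultant≡detSyl L L′)) ⟩
    ℓ * (sgn s * detℕ (degree L′ ℕ.+ degree L)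
                      (Syl (leadingFirst L (degree L)) 0 (leadingFirst L′ (degree L′)) 0 (degree L′)))
  ≡⟨ cong₂ (λ e e′ → ℓ * (sgn s * detℕ (e′ ℕ.+ e) (Syl (leadingFirst L e) 0 (leadingFirst L′ e′) 0 e′)))
           (degree-applyUpTo h (suc d)) (degree-applyUpTo (derivative h) d) ⟩
    ℓ * (sgn s * detℕ (d ℕ.+ suc d) (Syl (leadingFirst L (suc d)) 0 (leadingFirst L′ d) 0 d))
  ∎
  where
  open ≡-Reasoning
  s = (suc d ℕ.* (suc d ℕ.∸ 1)) ℕ./ 2
  L = applyUpTo h (suc (suc d))
  L′ = applyUpTo (derivative h) (suc d)
  ℓ = h (suc d)
  ℓ≢0 : ℓ ≢ 0ℤ
  ℓ≢0 = unit≢0 ℓ²≡1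
  leadL : lead L ≡ ℓ
  leadL = lead-applyUpTo h (suc d)
  -- the leading coefficient (d + 1)·ℓ of L′ is nonzero, so L′ is normalized
  derivL : normalize (deriv L) ≡ L′
  derivL = trans (cong normalize (deriv-applyUpTo h (suc d))) (normalize-applyUpTo (derivative h) d lead′≢0)
    where
    lead′≢0 : derivative h d ≢ 0ℤ
    lead′≢0 e with ℤP.i*j≡0⇒i≡0∨j≡0 (+ suc d) e
    ... | inj₁ ()
    ... | inj₂ ℓ≡0 = ℓ≢0 ℓ≡0

-- The rising factorial rise b k = (b + 1)(b + 2)⋯(b + k) = (b + k)! / b!.
rise : ℕ → ℕ → ℕ
rise b zero    = 1
rise b (suc k) = suc b ℕ.* rise (suc b) k

rise-step : ∀ b k → rise (suc b) (suc k) ≡ rise b (suc k) ℕ.+ suc k ℕ.* rise (suc b) k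
rise-step b zero    = base b
  where
  base : ∀ b → suc (suc b) ℕ.* 1 ≡ suc b ℕ.* 1 ℕ.+ 1 ℕ.* 1
  base = ℕSolver.solve-∀
rise-step b (suc k) =
  trans (cong (suc (suc b) ℕ.*_) (rise-step (suc b) k)) (collect b k (rise (suc (suc b)) k))
  where
  collect : ∀ b k R → suc (suc b) ℕ.* (suc (suc b) ℕ.* R ℕ.+ suc k ℕ.* R)
                      ≡ suc b ℕ.* (suc (suc b) ℕ.* R) ℕ.+ suc (suc k) ℕ.* (suc (suc b) ℕ.* R)
  collect = ℕSolver.solve-∀

C-absorb : ∀ n j → suc j ℕ.* (suc n C suc j) ≡ suc n ℕ.* (n C j)
C-absorb zero    zero    = refl
C-absorb zero    (suc j) = ℕP.*-zeroʳ (suc (suc j))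
C-absorb (suc n) zero    =
  trans (ℕP.+-identityʳ _) (trans (nC1≡n (suc (suc n))) (sym (ℕP.*-identityʳ (suc (suc n)))))
C-absorb (suc n) (suc j) =
  begin
    suc (suc j) ℕ.* (suc (suc n) C suc (suc j))
  ≡⟨ cong (suc (suc j) ℕ.*_) (sym (nCk+nC[k+1]≡[n+1]C[k+1] (suc n) (suc j))) ⟩
    suc (suc j) ℕ.* (A ℕ.+ B)
  ≡⟨ expand (suc j) A B ⟩
    A ℕ.+ suc j ℕ.* A ℕ.+ suc (suc j) ℕ.* B
  ≡⟨ cong₂ (λ x y → A ℕ.+ x ℕ.+ y) (C-absorb n j) (C-absorb n (suc j)) ⟩
    A ℕ.+ suc n ℕ.* (n C j) ℕ.+ suc n ℕ.* (n C suc j)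
  ≡⟨ collect A (suc n) (n C j) (n C suc j) ⟩
    A ℕ.+ suc n ℕ.* ((n C j) ℕ.+ (n C suc j))
  ≡⟨ cong (λ t → A ℕ.+ suc n ℕ.* t) (nCk+nC[k+1]≡[n+1]C[k+1] n j) ⟩
    A ℕ.+ suc n ℕ.* A
  ∎
  where
  open ≡-Reasoning
  A = suc n C suc j
  B = suc n C suc (suc j)
  expand : ∀ j A B → suc j ℕ.* (A ℕ.+ B) ≡ A ℕ.+ j ℕ.* A ℕ.+ suc j ℕ.* B
  expand = ℕSolver.solve-∀
  collect : ∀ A m x y → A ℕ.+ m ℕ.* x ℕ.+ m ℕ.* y ≡ A ℕ.+ m ℕ.* (x ℕ.+ y)
  collect = ℕSolver.solve-∀

C-complement : ∀ n k → k ≤ n → (suc n ℕ.∸ k) ℕ.* (suc n C k) ≡ suc n ℕ.* (n C k)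
C-complement n k k≤n =
  begin
    (suc n ℕ.∸ k) ℕ.* (suc n C k)
  ≡⟨ cong₂ ℕ._*_ n+1-k≡ (nCk≡nC[n∸k] (ℕP.m≤n⇒m≤1+n k≤n)) ⟩
    suc j ℕ.* (suc n C (suc n ℕ.∸ k))
  ≡⟨ cong (λ t → suc j ℕ.* (suc n C t)) n+1-k≡ ⟩
    suc j ℕ.* (suc n C suc j)
  ≡⟨ C-absorb n j ⟩
    suc n ℕ.* (n C j)
  ≡⟨ cong (suc n ℕ.*_) (sym (nCk≡nC[n∸k] k≤n)) ⟩
    suc n ℕ.* (n C k)
  ∎
  where
  open ≡-Reasoning
  j = n ℕ.∸ k
  n+1-k≡ : suc n ℕ.∸ k ≡ suc j
  n+1-k≡ = ℕP.+-∸-assoc 1 k≤n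

-- coeffP a b k = (b + k)!/b! · C(a, k) is the coefficient of x^(a - k) in
-- P(a, b); as a function of k it is the leading-first coefficient list of P(a, b).
coeffP : ℕ → ℕ → ℕ → ℤ
coeffP a b k = + (rise b k ℕ.* (a C k))

pos-sum : ∀ {x} y m z → x ≡ y ℕ.+ m ℕ.* z → + x ≡ + y + + m * + z
pos-sum y m z x≡ = trans (cong +_ x≡) (trans (ℤP.pos-+ y (m ℕ.* z)) (cong (_+_ (+ y)) (ℤP.pos-* m z)))

-- P(a + 1, b) = x·P(a, b) + (b + 1)·P(a, b + 1)   (Pascal's rule)
coeffP-sucA : ∀ a b k → coeffP (suc a) b k ≡ coeffP a b k + + suc b * delay (coeffP a (suc b)) 1 k
coeffP-sucA a b zero    = noCarry (coeffP a b 0) (+ suc b)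
  where
  noCarry : ∀ x s → x ≡ x + s * 0ℤ
  noCarry = solve-∀
coeffP-sucA a b (suc j) = pos-sum (rise b (suc j) ℕ.* (a C suc j)) (suc b) (R ℕ.* (a C j)) pascal
  where
  R = rise (suc b) j
  pascal : suc b ℕ.* R ℕ.* (suc a C suc j) ≡ suc b ℕ.* R ℕ.* (a C suc j) ℕ.+ suc b ℕ.* (R ℕ.* (a C j))
  pascal = trans (cong (suc b ℕ.* R ℕ.*_) (sym (nCk+nC[k+1]≡[n+1]C[k+1] a j)))
                 (distribute (suc b) R (a C j) (a C suc j))
    where
    distribute : ∀ s R x y → s ℕ.* R ℕ.* (x ℕ.+ y) ≡ s ℕ.* R ℕ.* y ℕ.+ s ℕ.* (R ℕ.* x)
    distribute = ℕSolver.solve-∀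

-- P(a + 1, b) = P(a + 1, b + 1) - (a + 1)·P(a, b + 1)
coeffP-sucB : ∀ a b k → coeffP (suc a) b k ≡ coeffP (suc a) (suc b) k + - (+ suc a * delay (coeffP a (suc b)) 1 k)
coeffP-sucB a b zero    = noCarry (+ 1) (+ suc a)
  where
  noCarry : ∀ x s → x ≡ x + - (s * 0ℤ)
  noCarry = solve-∀
coeffP-sucB a b (suc j) =
  trans (isolate (coeffP (suc a) b (suc j)) (+ suc a * + Q′))
        (cong (_+ - (+ suc a * + Q′)) (sym (pos-sum (rise b (suc j) ℕ.* Bin) (suc a) Q′ absorbed)))
  where
  R = rise (suc b) j
  Bin = suc a C suc j
  Q′ = R ℕ.* (a C j)
  absorbed : rise (suc b) (suc j) ℕ.* Bin ≡ rise b (suc j) ℕ.* Bin ℕ.+ suc a ℕ.* Q′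
  absorbed =
    begin
      rise (suc b) (suc j) ℕ.* Bin
    ≡⟨ cong (ℕ._* Bin) (rise-step b j) ⟩
      (rise b (suc j) ℕ.+ suc j ℕ.* R) ℕ.* Bin
    ≡⟨ distribute (rise b (suc j)) (suc j) R Bin ⟩
      rise b (suc j) ℕ.* Bin ℕ.+ R ℕ.* (suc j ℕ.* Bin)
    ≡⟨ cong (λ t → rise b (suc j) ℕ.* Bin ℕ.+ R ℕ.* t) (C-absorb a j) ⟩
      rise b (suc j) ℕ.* Bin ℕ.+ R ℕ.* (suc a ℕ.* (a C j))
    ≡⟨ cong (rise b (suc j) ℕ.* Bin ℕ.+_) (pull R (suc a) (a C j)) ⟩
      rise b (suc j) ℕ.* Bin ℕ.+ suc a ℕ.* Q′
    ∎
    where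
    open ≡-Reasoning
    distribute : ∀ y s R c → (y ℕ.+ s ℕ.* R) ℕ.* c ≡ y ℕ.* c ℕ.+ R ℕ.* (s ℕ.* c)
    distribute = ℕSolver.solve-∀
    pull : ∀ R s c → R ℕ.* (s ℕ.* c) ≡ s ℕ.* (R ℕ.* c)
    pull = ℕSolver.solve-∀
  isolate : ∀ y w → y ≡ (y + w) + - w
  isolate = solve-∀

coeffP-beyond : ∀ a b k → a ℕ.< k → coeffP a b k ≡ 0ℤ
coeffP-beyond a b k a<k = cong +_ (trans (cong (rise b k ℕ.*_) (k>n⇒nCk≡0 a<k)) (ℕP.*-zeroʳ (rise b k)))

-- The derivative of P(m + 1, b) is (m + 1)·P(m, b): the coefficient of
-- x^(m - k) in the derivative is (m + 1 - k) times that of x^(m + 1 - k).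
coeffP-derivative : ∀ m b k → + (suc m ℕ.∸ k) * coeffP (suc m) b k ≡ + suc m * coeffP m b k
coeffP-derivative m b k with k ℕP.≤? m
... | yes k≤m =
  trans (sym (ℤP.pos-* (suc m ℕ.∸ k) _))
 (trans (cong +_ (trans (swap (suc m ℕ.∸ k) (rise b k) (suc m C k))
                 (trans (cong (rise b k ℕ.*_) (C-complement m k k≤m)) (swap (rise b k) (suc m) (m C k)))))
        (ℤP.pos-* (suc m) _))
  where
  swap : ∀ x y z → x ℕ.* (y ℕ.* z) ≡ y ℕ.* (x ℕ.* z)
  swap = ℕSolver.solve-∀
... | no k≰m =
  trans (cong (λ t → + t * coeffP (suc m) b k) (ℕP.m≤n⇒m∸n≡0 (ℕP.≰⇒> k≰m)))
        (sym (trans (cong (+ suc m *_) (coeffP-beyond m b k (ℕP.≰⇒> k≰m))) (ℤP.*-zeroʳ (+ suc m))))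

-- Z a b = ∏_{j=1}^{a} j^j · ∏_{j=1}^{a} (b + 1 + j)^(a + 1 - j) (see Z-closed),
-- defined by the recursion that the resultants below satisfy.
Z : ℕ → ℕ → ℤ
Z zero    b = 1ℤ
Z (suc a) b = (+ suc a * + suc (suc b)) ^ suc a * Z a (suc b)

^-distribʳ-* : ∀ x y n → (x * y) ^ n ≡ x ^ n * y ^ n
^-distribʳ-* x y zero    = refl
^-distribʳ-* x y (suc n) = trans (cong ((x * y) *_) (^-distribʳ-* x y n)) (interchange x y (x ^ n) (y ^ n))
  where
  interchange : ∀ x y p q → x * y * (p * q) ≡ x * p * (y * q)
  interchange = solve-∀

-- The value of the discriminant of P(m + 1, b) up to sign: 1 for m = 0, and
-- (m + 1)^(m + 1) · ((b + 1) m)^m · Z (m - 1) b otherwise.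
discValue : ℕ → ℕ → ℤ
discValue zero    b = 1ℤ
discValue (suc a) b = (+ suc (suc a)) ^ suc (suc a) * ((+ suc b * + suc a) ^ suc a * Z a b)

-- For σ with σ² = 1, twisted a b k = σ^(a+k) · coeffP a b k is the
-- leading-first coefficient list of P(a, b)(σ x): σ = 1 describes P itself,
-- σ = -1 describes Q, since Q(u, v)(x) = P(v, u)(-x).
module Twisted (σ : ℤ) (σ²≡1 : σ * σ ≡ 1ℤ) where
  twisted : ℕ → ℕ → ℕ → ℤ
  twisted a b k = σ ^ (a ℕ.+ k) * coeffP a b k

  pow-square : ∀ n → σ ^ n * σ ^ n ≡ 1ℤ
  pow-square zero    = refl
  pow-square (suc n) = trans (regroup σ (σ ^ n)) (cong₂ _*_ σ²≡1 (pow-square n))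
    where
    regroup : ∀ s p → s * p * (s * p) ≡ (s * s) * (p * p)
    regroup = solve-∀

  twisted-lead² : ∀ a b → twisted a b 0 * twisted a b 0 ≡ 1ℤ
  twisted-lead² a b = trans (drop-ones (σ ^ (a ℕ.+ 0))) (pow-square (a ℕ.+ 0))
    where
    drop-ones : ∀ p → p * + 1 * (p * + 1) ≡ p * p
    drop-ones = solve-∀

  -- the extra power of σ carried by a delayed entry cancels in pairs
  twist-delay : ∀ m f k → σ ^ (suc m ℕ.+ k) * delay f 1 k ≡ delay (λ j → σ ^ (m ℕ.+ j) * f j) 1 k
  twist-delay m f zero    = ℤP.*-zeroʳ (σ ^ (suc m ℕ.+ 0))
  twist-delay m f (suc k) = cong (_* f k) (trans (cong (λ t → σ ^ suc t) (ℕP.+-suc m k)) twice)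
    where
    twice : σ ^ suc (suc (m ℕ.+ k)) ≡ σ ^ (m ℕ.+ k)
    twice = trans (sym (ℤP.*-assoc σ σ _)) (trans (cong (_* σ ^ (m ℕ.+ k)) σ²≡1) (ℤP.*-identityˡ _))

  -- P(a + 1, b)(σx) = σx·P(a, b)(σx) + (b + 1)·P(a, b + 1)(σx)
  twisted-sucA : ∀ a b k → twisted (suc a) b k ≡ σ * twisted a b k + + suc b * delay (twisted a (suc b)) 1 k
  twisted-sucA a b k =
    begin
      σ ^ (suc a ℕ.+ k) * coeffP (suc a) b k
    ≡⟨ cong (σ ^ (suc a ℕ.+ k) *_) (coeffP-sucA a b k) ⟩
      σ ^ (suc a ℕ.+ k) * (coeffP a b k + + suc b * delay (coeffP a (suc b)) 1 k)
    ≡⟨ distribute σ (σ ^ (a ℕ.+ k)) (coeffP a b k) (+ suc b) (delay (coeffP a (suc b)) 1 k) ⟩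
      σ * twisted a b k + + suc b * (σ ^ (suc a ℕ.+ k) * delay (coeffP a (suc b)) 1 k)
    ≡⟨ cong (λ t → σ * twisted a b k + + suc b * t) (twist-delay a (coeffP a (suc b)) k) ⟩
      σ * twisted a b k + + suc b * delay (twisted a (suc b)) 1 k
    ∎
    where
    open ≡-Reasoning
    distribute : ∀ s p r β q → (s * p) * (r + β * q) ≡ s * (p * r) + β * ((s * p) * q)
    distribute = solve-∀

  -- P(a + 1, b)(σx) = P(a + 1, b + 1)(σx) - (a + 1)·P(a, b + 1)(σx)
  twisted-sucB : ∀ a b k → twisted (suc a) b k ≡ twisted (suc a) (suc b) k + - (+ suc a * delay (twisted a (suc b)) 1 k)
  twisted-sucB a b k =
    begin
      σ ^ (suc a ℕ.+ k) * coeffP (suc a) b k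
    ≡⟨ cong (σ ^ (suc a ℕ.+ k) *_) (coeffP-sucB a b k) ⟩
      σ ^ (suc a ℕ.+ k) * (coeffP (suc a) (suc b) k + - (+ suc a * delay (coeffP a (suc b)) 1 k))
    ≡⟨ distribute (σ ^ (suc a ℕ.+ k)) (coeffP (suc a) (suc b) k) (+ suc a) (delay (coeffP a (suc b)) 1 k) ⟩
      twisted (suc a) (suc b) k + - (+ suc a * (σ ^ (suc a ℕ.+ k) * delay (coeffP a (suc b)) 1 k))
    ≡⟨ cong (λ t → twisted (suc a) (suc b) k + - (+ suc a * t)) (twist-delay a (coeffP a (suc b)) k) ⟩
      twisted (suc a) (suc b) k + - (+ suc a * delay (twisted a (suc b)) 1 k)
    ∎
    where
    open ≡-Reasoning
    distribute : ∀ p r α q → p * (r + - (α * q)) ≡ p * r + - (α * (p * q))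
    distribute = solve-∀

  -- P(a + 2, b) = (σx + (b + 1))·P(a + 1, b) + (b + 1)(a + 1)·P(a, b + 1)   (at σx)
  firstRelation : ∀ a b → ThreeTerm (twisted (suc (suc a)) b) (twisted (suc a) b)
    (λ k → (+ suc b * + suc a) * twisted a (suc b) k) σ (+ suc b)
  firstRelation a b k =
    begin
      twisted (suc (suc a)) b k
    ≡⟨ twisted-sucA (suc a) b k ⟩
      σ * G k + β * delay (twisted (suc a) (suc b)) 1 k
    ≡⟨ cong (λ t → σ * G k + β * t) (raised k) ⟩
      σ * G k + β * (delay G 1 k + α * delay (twisted a (suc b)) 2 k)
    ≡⟨ distribute σ (G k) β (delay G 1 k) α (delay (twisted a (suc b)) 2 k) ⟩
      σ * G k + β * delay G 1 k + (β * α) * delay (twisted a (suc b)) 2 k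
    ≡⟨ cong (λ t → σ * G k + β * delay G 1 k + t) (sym (delay-scale (β * α) (twisted a (suc b)) 2 k)) ⟩
      σ * G k + β * delay G 1 k + delay (λ k → (β * α) * twisted a (suc b) k) 2 k
    ∎
    where
    open ≡-Reasoning
    α = + suc a
    β = + suc b
    G = twisted (suc a) b
    raised : ∀ k → delay (twisted (suc a) (suc b)) 1 k ≡ delay G 1 k + α * delay (twisted a (suc b)) 2 k
    raised zero    = zeros α
      where
      zeros : ∀ α → 0ℤ ≡ 0ℤ + α * 0ℤ
      zeros = solve-∀
    raised (suc k) = trans (isolate (twisted (suc a) (suc b) k) (α * delay (twisted a (suc b)) 1 k))
                           (cong (_+ α * delay (twisted a (suc b)) 1 k) (sym (twisted-sucB a b k)))
      where
      isolate : ∀ x y → x ≡ (x + - y) + y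
      isolate = solve-∀
    distribute : ∀ s g β v α w → s * g + β * (v + α * w) ≡ s * g + β * v + (β * α) * w
    distribute = solve-∀

  -- P(a + 2, b) = (σx + (b - a))·P(a + 1, b + 1) + (a + 1)(b + 2)·P(a, b + 2)   (at σx)
  chainRelation : ∀ a b → ThreeTerm (twisted (suc (suc a)) b) (twisted (suc a) (suc b))
    (λ k → (+ suc a * + suc (suc b)) * twisted a (suc (suc b)) k) σ (+ suc b + - + suc a)
  chainRelation a b k =
    begin
      twisted (suc (suc a)) b k
    ≡⟨ twisted-sucA (suc a) b k ⟩
      σ * twisted (suc a) b k + β * V
    ≡⟨ cong₂ (λ x v → σ * x + β * v) (twisted-sucB a b k) V≡ ⟩
      σ * (G k + - (α * W)) + β * (σ * W + β′ * U)
    ≡⟨ rearrange σ (G k) α W β β′ U ⟩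
      σ * G k + (β + - α) * (σ * W + β′ * U) + (α * β′) * U
    ≡⟨ cong₂ (λ v u → σ * G k + (β + - α) * v + u) (sym V≡)
             (sym (delay-scale (α * β′) (twisted a (suc (suc b))) 2 k)) ⟩
      σ * G k + (β + - α) * V + delay (λ k → (α * β′) * twisted a (suc (suc b)) k) 2 k
    ∎
    where
    open ≡-Reasoning
    α = + suc a
    β = + suc b
    β′ = + suc (suc b)
    G = twisted (suc a) (suc b)
    V = delay G 1 k
    W = delay (twisted a (suc b)) 1 k
    U = delay (twisted a (suc (suc b))) 2 k
    delayed : ∀ k → delay G 1 k ≡ σ * delay (twisted a (suc b)) 1 k + β′ * delay (twisted a (suc (suc b))) 2 k
    delayed zero     = sym (zeros σ β′)
      where
      zeros : ∀ s β′ → s * 0ℤ + β′ * 0ℤ ≡ 0ℤ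
      zeros = solve-∀
    delayed (suc k′) = twisted-sucA a (suc b) k′
    V≡ : V ≡ σ * W + β′ * U
    V≡ = delayed k
    rearrange : ∀ s g α t β β′ u → s * (g + - (α * t)) + β * (s * t + β′ * u)
                                   ≡ s * g + (β + - α) * (s * t + β′ * u) + (α * β′) * u
    rearrange = solve-∀

  twisted-beyond : ∀ a b k → a ℕ.< k → twisted a b k ≡ 0ℤ
  twisted-beyond a b k a<k = trans (cong (σ ^ (a ℕ.+ k) *_) (coeffP-beyond a b k a<k)) (ℤP.*-zeroʳ (σ ^ (a ℕ.+ k)))

  twisted-derivative : ∀ m b k → + (suc m ℕ.∸ k) * twisted (suc m) b k ≡ (σ * + suc m) * twisted m b k
  twisted-derivative m b k =
    trans (regroup (+ (suc m ℕ.∸ k)) σ (σ ^ (m ℕ.+ k)) (coeffP (suc m) b k))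
   (trans (cong (λ t → σ * σ ^ (m ℕ.+ k) * t) (coeffP-derivative m b k))
          (regroup′ σ (σ ^ (m ℕ.+ k)) (+ suc m) (coeffP m b k)))
    where
    regroup : ∀ d s p c → d * (s * p * c) ≡ s * p * (d * c)
    regroup = solve-∀
    regroup′ : ∀ s p n c → s * p * (n * c) ≡ (s * n) * (p * c)
    regroup′ = solve-∀

  -- Res(P(a + 1, b), P(a, b + 1)) and Res(P(a, b + 1), P(a + 1, b)), at σx.
  resUp resDown : ℕ → ℕ → ℤ
  resUp   a b = detℕ (a ℕ.+ suc a) (Syl (twisted (suc a) b) 0 (twisted a (suc b)) 0 a)
  resDown a b = detℕ (suc a ℕ.+ a) (Syl (twisted a (suc b)) 0 (twisted (suc a) b) 0 (suc a))

  -- Both equal Z a b: by the chain relation each is, up to the square of a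
  -- leading coefficient ±1 and a power of (a + 1)(b + 2), the other one for
  -- (a - 1, b + 1).
  consecutive : ∀ a b → resUp a b ≡ Z a b × resDown a b ≡ Z a b
  consecutive zero    b = refl , refl
  consecutive (suc a) b = up , down
    where
    F = twisted (suc (suc a)) b
    G = twisted (suc a) (suc b)
    K = twisted a (suc (suc b))
    c = + suc a * + suc (suc b)
    e = + suc b + - + suc a
    H = λ k → c * K k
    rel : ThreeTerm F G H σ e
    rel = chainRelation a b
    ih = consecutive a (suc b)
    N₁ = suc a ℕ.+ a
    N₂ = a ℕ.+ suc a
    up : resUp (suc a) b ≡ Z (suc a) b
    up =
      begin
        detℕ (suc a ℕ.+ suc (suc a)) (Syl F 0 G 0 (suc a))
      ≡⟨ detℕ-size (Syl F 0 G 0 (suc a)) (cong suc (trans (ℕP.+-suc a (suc a)) (cong suc (ℕP.+-suc a a)))) ⟩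
        detℕ (suc (suc N₁)) (Syl F 0 G 0 (suc a))
      ≡⟨ Syl-eliminateUpper N₁ (suc a) F G H σ e rel (ℕP.m≤m+n (suc a) a) (ℕP.≤-reflexive (cong suc (ℕP.+-suc a a))) ⟩
        G 0 * G 0 * detℕ N₁ (Syl H 0 G 0 (suc a))
      ≡⟨ cong₂ _*_ (twisted-lead² (suc a) (suc b)) (Syl-scaleUpper N₁ (suc a) K G c (ℕP.m≤m+n (suc a) a)) ⟩
        1ℤ * (c ^ suc a * resDown a (suc b))
      ≡⟨ trans (ℤP.*-identityˡ _) (cong (c ^ suc a *_) (proj₂ ih)) ⟩
        Z (suc a) b
      ∎
      where open ≡-Reasoning
    down : resDown (suc a) b ≡ Z (suc a) b
    down =
      begin
        detℕ (suc (suc N₂)) (Syl G 0 F 0 (suc (suc a)))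
      ≡⟨ Syl-eliminateLower N₂ a F G H σ e rel (ℕP.m≤m+n a (suc a)) ℕP.≤-refl ⟩
        G 0 * G 0 * detℕ N₂ (Syl G 0 H 0 a)
      ≡⟨ cong₂ _*_ (twisted-lead² (suc a) (suc b)) (Syl-scaleLower N₂ a G K c (ℕP.m≤m+n a (suc a))) ⟩
        1ℤ * (c ^ (N₂ ℕ.∸ a) * resUp a (suc b))
      ≡⟨ trans (ℤP.*-identityˡ _) (cong₂ (λ n x → c ^ n * x) (ℕP.m+n∸m≡n a (suc a)) (proj₁ ih)) ⟩
        Z (suc a) b
      ∎
      where open ≡-Reasoning

  -- Res(P(a + 2, b), κ·P(a + 1, b)) at σx: by the first relation it reduces
  -- to resDown a b.
  res-consecutive : ∀ a b κ →
    detℕ (suc a ℕ.+ suc (suc a)) (Syl (twisted (suc (suc a)) b) 0 (λ k → κ * twisted (suc a) b k) 0 (suc a))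
    ≡ κ ^ suc (suc a) * ((+ suc b * + suc a) ^ suc a * Z a b)
  res-consecutive a b κ =
    begin
      detℕ N (Syl F 0 (λ k → κ * G k) 0 (suc a))
    ≡⟨ Syl-scaleLower N (suc a) F G κ (ℕP.m≤m+n (suc a) (suc (suc a))) ⟩
      κ ^ (N ℕ.∸ suc a) * detℕ N (Syl F 0 G 0 (suc a))
    ≡⟨ cong₂ (λ e x → κ ^ e * x) (ℕP.m+n∸m≡n (suc a) (suc (suc a)))
             (detℕ-size (Syl F 0 G 0 (suc a)) (cong suc (trans (ℕP.+-suc a (suc a)) (cong suc (ℕP.+-suc a a))))) ⟩
      κ ^ suc (suc a) * detℕ (suc (suc N₁)) (Syl F 0 G 0 (suc a))
    ≡⟨ cong (κ ^ suc (suc a) *_) (Syl-eliminateUpper N₁ (suc a) F G H σ (+ suc b) (firstRelation a b)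
                                  (ℕP.m≤m+n (suc a) a) (ℕP.≤-reflexive (cong suc (ℕP.+-suc a a)))) ⟩
      κ ^ suc (suc a) * (G 0 * G 0 * detℕ N₁ (Syl H 0 G 0 (suc a)))
    ≡⟨ cong (κ ^ suc (suc a) *_) (cong₂ _*_ (twisted-lead² (suc a) b)
                                            (Syl-scaleUpper N₁ (suc a) (twisted a (suc b)) G c (ℕP.m≤m+n (suc a) a))) ⟩
      κ ^ suc (suc a) * (1ℤ * (c ^ suc a * resDown a b))
    ≡⟨ cong (κ ^ suc (suc a) *_) (trans (ℤP.*-identityˡ _) (cong (c ^ suc a *_) (proj₂ (consecutive a b)))) ⟩
      κ ^ suc (suc a) * (c ^ suc a * Z a b)
    ∎
    where
    open ≡-Reasoning
    N = suc a ℕ.+ suc (suc a)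
    N₁ = suc a ℕ.+ a
    c = + suc b * + suc a
    F = twisted (suc (suc a)) b
    G = twisted (suc a) b
    H = λ k → c * twisted a (suc b) k

  res-linear : ∀ b κ → detℕ 1 (Syl (twisted 1 b) 0 (λ k → κ * twisted 0 b k) 0 0) ≡ κ
  res-linear b κ = simplify κ
    where
    simplify : ∀ k → 1ℤ * (k * (1ℤ * + 1)) * 1ℤ + 0ℤ ≡ k
    simplify = solve-∀

  lead·resultant : ∀ m b →
    twisted (suc m) b 0 * detℕ (m ℕ.+ suc m) (Syl (twisted (suc m) b) 0 (λ k → (σ * + suc m) * twisted m b k) 0 m)
    ≡ discValue m b
  lead·resultant zero    b = trans (cong (twisted 1 b 0 *_) (res-linear b (σ * + 1)))
                                   (trans (square σ) σ²≡1)
    where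
    square : ∀ s → s * 1ℤ * + 1 * (s * + 1) ≡ s * s
    square = solve-∀
  lead·resultant (suc a) b =
    begin
      twisted (suc (suc a)) b 0 *
      detℕ (suc a ℕ.+ suc (suc a)) (Syl (twisted (suc (suc a)) b) 0 (λ k → κ * twisted (suc a) b k) 0 (suc a))
    ≡⟨ cong₂ _*_ (cong (λ n → σ ^ n * + 1) (ℕP.+-identityʳ (suc (suc a)))) (res-consecutive a b κ) ⟩
      σ ^ suc (suc a) * + 1 * (κ ^ suc (suc a) * rest)
    ≡⟨ cong (λ t → σ ^ suc (suc a) * + 1 * (t * rest)) (^-distribʳ-* σ (+ suc (suc a)) (suc (suc a))) ⟩
      σ ^ suc (suc a) * + 1 * (σ ^ suc (suc a) * (+ suc (suc a)) ^ suc (suc a) * rest)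
    ≡⟨ regroup (σ ^ suc (suc a)) ((+ suc (suc a)) ^ suc (suc a)) rest ⟩
      σ ^ suc (suc a) * σ ^ suc (suc a) * ((+ suc (suc a)) ^ suc (suc a) * rest)
    ≡⟨ trans (cong (_* ((+ suc (suc a)) ^ suc (suc a) * rest)) (pow-square (suc (suc a)))) (ℤP.*-identityˡ _) ⟩
      discValue (suc a) b
    ∎
    where
    open ≡-Reasoning
    κ = σ * + suc (suc a)
    rest = (+ suc b * + suc a) ^ suc a * Z a b
    regroup : ∀ p q r → p * + 1 * (p * q * r) ≡ p * p * (q * r)
    regroup = solve-∀

  leadingFirst-derivative : ∀ h m b → (∀ k → k ≤ suc m → h (suc m ℕ.∸ k) ≡ twisted (suc m) b k) →
    ∀ k → leadingFirst (applyUpTo (derivative h) (suc m)) m k ≡ (σ * + suc m) * twisted m b k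
  leadingFirst-derivative h m b coeffs = leadingFirst-applyUpTo (derivative h) _ m inRange beyond
    where
    inRange : ∀ k → k ≤ m → derivative h (m ℕ.∸ k) ≡ (σ * + suc m) * twisted m b k
    inRange k k≤m =
      trans (cong (λ t → + t * h t) (sym (ℕP.+-∸-assoc 1 k≤m)))
     (trans (cong (+ (suc m ℕ.∸ k) *_) (coeffs k (ℕP.m≤n⇒m≤1+n k≤m)))
            (twisted-derivative m b k))
    beyond : ∀ k → m ℕ.< k → (σ * + suc m) * twisted m b k ≡ 0ℤ
    beyond k m<k = trans (cong ((σ * + suc m) *_) (twisted-beyond m b k m<k)) (ℤP.*-zeroʳ (σ * + suc m))

  disc-twisted : ∀ h m b → (∀ k → k ≤ suc m → h (suc m ℕ.∸ k) ≡ twisted (suc m) b k) →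
    disc (applyUpTo h (suc (suc m))) ≡ sgn ((suc m ℕ.* (suc m ℕ.∸ 1)) ℕ./ 2) * discValue m b
  disc-twisted h m b coeffs =
    begin
      disc (applyUpTo h (suc (suc m)))
    ≡⟨ disc-applyUpTo h m ℓ²≡1 ⟩
      ℓ * (sgn s * detℕ (m ℕ.+ suc m) (Syl (leadingFirst L (suc m)) 0 (leadingFirst L′ m) 0 m))
    ≡⟨ cong (λ t → ℓ * (sgn s * t)) (detℕ-cong (m ℕ.+ suc m) (λ r c _ _ → Syl-cong 0 0 m upper lower r c)) ⟩
      ℓ * (sgn s * detℕ (m ℕ.+ suc m) (Syl (twisted (suc m) b) 0 (λ k → κ * twisted m b k) 0 m))
    ≡⟨ sym (commute ℓ (sgn s) _) ⟩
      sgn s * (ℓ * detℕ (m ℕ.+ suc m) (Syl (twisted (suc m) b) 0 (λ k → κ * twisted m b k) 0 m))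
    ≡⟨ cong (sgn s *_) (trans (cong (_* _) ℓ≡) (lead·resultant m b)) ⟩
      sgn s * discValue m b
    ∎
    where
    open ≡-Reasoning
    s = (suc m ℕ.* (suc m ℕ.∸ 1)) ℕ./ 2
    κ = σ * + suc m
    L = applyUpTo h (suc (suc m))
    L′ = applyUpTo (derivative h) (suc m)
    ℓ = h (suc m)
    ℓ≡ : ℓ ≡ twisted (suc m) b 0
    ℓ≡ = coeffs 0 z≤n
    ℓ²≡1 : ℓ * ℓ ≡ 1ℤ
    ℓ²≡1 = trans (cong (λ x → x * x) ℓ≡) (twisted-lead² (suc m) b)
    upper : ∀ k → leadingFirst L (suc m) k ≡ twisted (suc m) b k
    upper = leadingFirst-applyUpTo h (twisted (suc m) b) (suc m) coeffs (twisted-beyond (suc m) b)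
    lower : ∀ k → leadingFirst L′ m k ≡ κ * twisted m b k
    lower = leadingFirst-derivative h m b coeffs
    commute : ∀ x y z → y * (x * z) ≡ x * (y * z)
    commute = solve-∀

factorial-rise : ∀ v k → (v ℕ.+ k) ! ≡ v ! ℕ.* rise v k
factorial-rise v zero    = trans (cong _! (ℕP.+-identityʳ v)) (sym (ℕP.*-identityʳ (v !)))
factorial-rise v (suc k) =
  trans (cong _! (ℕP.+-suc v k)) (trans (factorial-rise (suc v) k) (reassociate v (v !) (rise (suc v) k)))
  where
  reassociate : ∀ v f r → (suc v ℕ.* f) ℕ.* r ≡ f ℕ.* (suc v ℕ.* r)
  reassociate = ℕSolver.solve-∀

factorial-quotient : ∀ v k → (((v ℕ.+ k) !) ℕ./ (v !)) {{v !≢0}} ≡ rise v k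
factorial-quotient v k =
  trans (cong (λ t → (t ℕ./ (v !)) {{v !≢0}}) (trans (factorial-rise v k) (ℕP.*-comm (v !) (rise v k))))
        (ℕDM.m*n/n≡m (rise v k) (v !) {{v !≢0}})

+-∸-∸ : ∀ u v k → k ≤ u → u ℕ.+ v ℕ.∸ (u ℕ.∸ k) ≡ v ℕ.+ k
+-∸-∸ u v k k≤u =
  trans (ℕP.+-∸-comm v (ℕP.m∸n≤m u k)) (trans (cong (ℕ._+ v) (ℕP.m∸[m∸n]≡n k≤u)) (ℕP.+-comm k v))

sgn-+-double : ∀ n k → sgn (n ℕ.+ (k ℕ.+ k)) ≡ sgn n
sgn-+-double n zero    = cong sgn (ℕP.+-identityʳ n)
sgn-+-double n (suc k) = trans (cong sgn n+2k+2≡) (trans (two-signs (sgn (n ℕ.+ (k ℕ.+ k)))) (sgn-+-double n k))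
  where
  n+2k+2≡ : n ℕ.+ (suc k ℕ.+ suc k) ≡ suc (suc (n ℕ.+ (k ℕ.+ k)))
  n+2k+2≡ = trans (cong (n ℕ.+_) (cong suc (ℕP.+-suc k k)))
                  (trans (ℕP.+-suc n (suc (k ℕ.+ k))) (cong suc (ℕP.+-suc n (k ℕ.+ k))))
  two-signs : ∀ s → -1ℤ * (-1ℤ * s) ≡ s
  two-signs = solve-∀

sgn-∸ : ∀ v k → k ≤ v → sgn (v ℕ.∸ k) ≡ sgn (v ℕ.+ k)
sgn-∸ v k k≤v = sym (trans (cong sgn v+k≡) (sgn-+-double (v ℕ.∸ k) k))
  where
  v+k≡ : v ℕ.+ k ≡ (v ℕ.∸ k) ℕ.+ (k ℕ.+ k)
  v+k≡ = trans (cong (ℕ._+ k) (sym (ℕP.m∸n+n≡m k≤v))) (ℕP.+-assoc (v ℕ.∸ k) k k)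

module Plus  = Twisted 1ℤ refl
module Minus = Twisted -1ℤ refl

coefP coefQ : ℕ → ℕ → ℕ → ℤ
coefP u v j = + (((((u ℕ.+ v) ℕ.∸ j) !) ℕ./ (v !)) {{v !≢0}} ℕ.* (u C j))
coefQ u v j = sgn j * + (((((u ℕ.+ v) ℕ.∸ j) !) ℕ./ (u !)) {{u !≢0}} ℕ.* (v C j))

coefP-leadingFirst : ∀ u v k → k ≤ u → coefP u v (u ℕ.∸ k) ≡ Plus.twisted u v k
coefP-leadingFirst u v k k≤u =
  trans (cong +_ (cong₂ ℕ._*_
          (trans (cong (λ t → ((t !) ℕ./ (v !)) {{v !≢0}}) (+-∸-∸ u v k k≤u)) (factorial-quotient v k))
          (sym (nCk≡nC[n∸k] k≤u))))
        (sym (trans (cong (_* coeffP u v k) (ℤP.^-zeroˡ (u ℕ.+ k))) (ℤP.*-identityˡ _)))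

coefQ-leadingFirst : ∀ u v k → k ≤ v → coefQ u v (v ℕ.∸ k) ≡ Minus.twisted v u k
coefQ-leadingFirst u v k k≤v = cong₂ _*_ (sgn-∸ v k k≤v) (cong +_ (cong₂ ℕ._*_
  (trans (cong (λ t → ((t !) ℕ./ (u !)) {{u !≢0}}) (trans (cong (ℕ._∸ (v ℕ.∸ k)) (ℕP.+-comm u v)) (+-∸-∸ v u k k≤v)))
         (factorial-quotient u k))
  (sym (nCk≡nC[n∸k] k≤v))))

∏ : ℕ → (ℕ → ℤ) → ℤ
∏ zero    f = 1ℤ
∏ (suc n) f = f 0 * ∏ n (λ i → f (suc i))

∏-cong : ∀ n {f g : ℕ → ℤ} → (∀ i → f i ≡ g i) → ∏ n f ≡ ∏ n g
∏-cong zero    h = refl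
∏-cong (suc n) h = cong₂ _*_ (h 0) (∏-cong n (λ i → h (suc i)))

∏-last : ∀ n f → ∏ (suc n) f ≡ ∏ n f * f n
∏-last zero    f = trans (ℤP.*-identityʳ (f 0)) (sym (ℤP.*-identityˡ (f 0)))
∏-last (suc n) f = trans (cong (f 0 *_) (∏-last n (λ i → f (suc i)))) (sym (ℤP.*-assoc (f 0) _ _))

prodFrom1≡∏ : ∀ b t → prodFrom 1 b t ≡ ∏ b (λ i → t (suc i))
prodFrom1≡∏ b t = go (λ i → i) b
  where
  go : ∀ (f : ℕ → ℕ) n → L.foldr _*_ 1ℤ (L.map (λ i → t (1 ℕ.+ i)) (applyUpTo f n)) ≡ ∏ n (λ i → t (suc (f i)))
  go f zero    = refl
  go f (suc n) = cong (t (suc (f 0)) *_) (go (λ i → f (suc i)) n)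

Z-closed : ∀ a b → Z a b ≡ ∏ a (λ i → (+ suc i) ^ suc i) * ∏ a (λ i → (+ (suc (suc b) ℕ.+ i)) ^ (a ℕ.∸ i))
Z-closed zero    b = refl
Z-closed (suc a) b =
  begin
    (+ suc a * + suc (suc b)) ^ suc a * Z a (suc b)
  ≡⟨ cong₂ _*_ (^-distribʳ-* (+ suc a) (+ suc (suc b)) (suc a)) (Z-closed a (suc b)) ⟩
    ((+ suc a) ^ suc a * (+ suc (suc b)) ^ suc a) * (Π₁ * Π₂)
  ≡⟨ regroup ((+ suc a) ^ suc a) ((+ suc (suc b)) ^ suc a) Π₁ Π₂ ⟩
    (Π₁ * (+ suc a) ^ suc a) * ((+ suc (suc b)) ^ suc a * Π₂)
  ≡⟨ cong₂ _*_ (sym (∏-last a (λ i → (+ suc i) ^ suc i)))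
       (cong₂ _*_ (cong (λ t → (+ t) ^ suc a) (sym (ℕP.+-identityʳ (suc (suc b)))))
                  (∏-cong a (λ i → cong (λ t → (+ t) ^ (a ℕ.∸ i)) (sym (ℕP.+-suc (suc (suc b)) i))))) ⟩
    ∏ (suc a) (λ i → (+ suc i) ^ suc i) * ∏ (suc a) (λ i → (+ (suc (suc b) ℕ.+ i)) ^ (suc a ℕ.∸ i))
  ∎
  where
  open ≡-Reasoning
  Π₁ = ∏ a (λ i → (+ suc i) ^ suc i)
  Π₂ = ∏ a (λ i → (+ (suc (suc (suc b)) ℕ.+ i)) ^ (a ℕ.∸ i))
  regroup : ∀ A B p q → (A * B) * (p * q) ≡ (p * A) * (B * q)
  regroup = solve-∀

discValue-product : ∀ m v →
  discValue m v ≡ prodFrom 1 (suc m) (λ j → (+ j) ^ j) * prodFrom 1 m (λ j → (+ (v ℕ.+ j)) ^ (suc m ℕ.∸ j))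
discValue-product zero    v = refl
discValue-product (suc a) v =
  begin
    A₂ * ((+ suc v * + suc a) ^ suc a * Z a v)
  ≡⟨ cong₂ (λ x y → A₂ * (x * y)) (^-distribʳ-* (+ suc v) (+ suc a) (suc a)) (Z-closed a v) ⟩
    A₂ * ((V * A₁) * (Π₁ * Π₂))
  ≡⟨ regroup A₂ V A₁ Π₁ Π₂ ⟩
    (Π₁ * A₁ * A₂) * (V * Π₂)
  ≡⟨ cong₂ _*_ (sym (trans (∏-last (suc a) (λ i → (+ suc i) ^ suc i))
                           (cong (_* A₂) (∏-last a (λ i → (+ suc i) ^ suc i)))))
       (cong₂ _*_ (cong (λ t → (+ t) ^ suc a) (ℕP.+-comm 1 v))
                  (∏-cong a (λ i → cong (λ t → (+ t) ^ (a ℕ.∸ i)) (shift i)))) ⟩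
    ∏ (suc (suc a)) (λ i → (+ suc i) ^ suc i) * ∏ (suc a) (λ i → (+ (v ℕ.+ suc i)) ^ (suc (suc a) ℕ.∸ suc i))
  ≡⟨ sym (cong₂ _*_ (prodFrom1≡∏ (suc (suc a)) (λ j → (+ j) ^ j))
                    (prodFrom1≡∏ (suc a) (λ j → (+ (v ℕ.+ j)) ^ (suc (suc a) ℕ.∸ j)))) ⟩
    prodFrom 1 (suc (suc a)) (λ j → (+ j) ^ j) * prodFrom 1 (suc a) (λ j → (+ (v ℕ.+ j)) ^ (suc (suc a) ℕ.∸ j))
  ∎
  where
  open ≡-Reasoning
  A₂ = (+ suc (suc a)) ^ suc (suc a)
  A₁ = (+ suc a) ^ suc a
  V = (+ suc v) ^ suc a
  Π₁ = ∏ a (λ i → (+ suc i) ^ suc i)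
  Π₂ = ∏ a (λ i → (+ (suc (suc v) ℕ.+ i)) ^ (a ℕ.∸ i))
  regroup : ∀ A₂ V A₁ p q → A₂ * ((V * A₁) * (p * q)) ≡ (p * A₁ * A₂) * (V * q)
  regroup = solve-∀
  shift : ∀ i → suc (suc v) ℕ.+ i ≡ v ℕ.+ suc (suc i)
  shift i = sym (trans (ℕP.+-suc v (suc i)) (cong suc (ℕP.+-suc v i)))

discValue≡Δ : ∀ m v → sgn ((suc m ℕ.* (suc m ℕ.∸ 1)) ℕ./ 2) * discValue m v ≡ Δ (suc m) v
discValue≡Δ m v = trans (cong (sign *_) (discValue-product m v))
                        (sym (ℤP.*-assoc sign (prodFrom 1 (suc m) (λ j → (+ j) ^ j))
                                              (prodFrom 1 m (λ j → (+ (v ℕ.+ j)) ^ (suc m ℕ.∸ j)))))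
  where
  sign = sgn ((suc m ℕ.* (suc m ℕ.∸ 1)) ℕ./ 2)

proposition2p1 : (u v : ℕ) → 1 ≤ u → 1 ≤ v →
    (disc (P u v) ≡ Δ u v) × (disc (Q u v) ≡ Δ v u)
proposition2p1 (suc m) (suc n) _ _ = discP , discQ
  where
  open ≡-Reasoning
  discP : disc (P (suc m) (suc n)) ≡ Δ (suc m) (suc n)
  discP =
    begin
      disc (P (suc m) (suc n))
    ≡⟨ cong disc (tab≡applyUpTo (suc m) (coefP (suc m) (suc n))) ⟩
      disc (applyUpTo (coefP (suc m) (suc n)) (suc (suc m)))
    ≡⟨ Plus.disc-twisted (coefP (suc m) (suc n)) m (suc n) (coefP-leadingFirst (suc m) (suc n)) ⟩
      sgn ((suc m ℕ.* m) ℕ./ 2) * discValue m (suc n)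
    ≡⟨ discValue≡Δ m (suc n) ⟩
      Δ (suc m) (suc n)
    ∎
  discQ : disc (Q (suc m) (suc n)) ≡ Δ (suc n) (suc m)
  discQ =
    begin
      disc (Q (suc m) (suc n))
    ≡⟨ cong disc (tab≡applyUpTo (suc n) (coefQ (suc m) (suc n))) ⟩
      disc (applyUpTo (coefQ (suc m) (suc n)) (suc (suc n)))
    ≡⟨ Minus.disc-twisted (coefQ (suc m) (suc n)) n (suc m) (coefQ-leadingFirst (suc m) (suc n)) ⟩
      sgn ((suc n ℕ.* n) ℕ./ 2) * discValue n (suc m)
    ≡⟨ discValue≡Δ n (suc m) ⟩
      Δ (suc n) (suc m)
    ∎
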